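{- For $n\ge1$ let $a(n,j)$ (resp. $\bar a(n,j)$) be the number of permutations in $\mathfrak{S}_n$ with $j$ descents at odd positions and no descents (resp. no ascents) at even positions, so that $A_n(x,0)=\sum_{j=0}^{\lfloor n/2\rfloor}a(n,j)x^j$ and $\widehat{A}_n(x,0)=\sum_{j=0}^{\lfloor n/2\rfloor}\bar a(n,j)x^j$. Then $$\widetilde{A}_n(x,y)=\sum_{j=0}^{\lfloor n/2\rfloor}a(n,j)\,(x+y)^j(1+xy)^{\lfloor n/2\rfloor-j},\qquad \overline{A}_n(x,y)=\sum_{j=0}^{\lfloor n/2\rfloor}\bar a(n,j)\,(x+y)^j(1+xy)^{\lfloor n/2\rfloor-j}.$$ Moreover, $\bar a(n,j)=a(n,\lfloor n/2\rfloor-j)$ for $0\le j\le\lfloor n/2\rfloor$.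
   Context: For $\sigma\in\mathfrak{S}_n$, a position $i\in[n-1]$ is a descent if $\sigma(i)>\sigma(i+1)$ and an ascent if $\sigma(i)<\sigma(i+1)$. $\mathrm{des}_1\sigma$ (resp. $\mathrm{des}_0\sigma$) is the number of descents at odd (resp. even) positions, and $\mathrm{asc}_0\sigma$ the number of ascents at even positions. $A_n(x,y)=\sum_{\sigma\in\mathfrak{S}_n}x^{\mathrm{des}_1\sigma}y^{\mathrm{des}_0\sigma}$ and $\widehat{A}_n(x,y)=\sum_{\sigma\in\mathfrak{S}_n}x^{\mathrm{des}_1\sigma}y^{\mathrm{asc}_0\sigma}$. For $m\ge1$: $\widetilde{A}_{2m}(x,y)=(1+y)A_{2m}(x,y)$, $\widetilde{A}_{2m-1}(x,y)=A_{2m-1}(x,y)$, $\overline{A}_{2m}(x,y)=(1+y)\widehat{A}_{2m}(x,y)$, $\overline{A}_{2m-1}(x,y)=\widehat{A}_{2m-1}(x,y)$. -}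

module Defs where

open import Data.Nat as N using (ℕ; zero; suc; _∸_; _<ᵇ_)
open import Data.Nat.DivMod using (_/_)
open import Data.Bool using (Bool; true; false; not; _∧_; if_then_else_)
open import Data.List using (List; []; _∷_; map; concatMap; sum; upTo; filterᵇ; length)
open import Data.Integer as ℤ using (ℤ; +_; _^_)

insertions : ℕ → List ℕ → List (List ℕ)
insertions x [] = (x ∷ []) ∷ []
insertions x (y ∷ ys) = (x ∷ y ∷ ys) ∷ map (y ∷_) (insertions x ys)

-- The symmetric group S_n, each permutation σ given in one-line notation
-- [σ(1), …, σ(n)] on the letters 0,…,n-1 (every permutation exactly once).
perms : ℕ → List (List ℕ)
perms zero = [] ∷ []
perms (suc n) = concatMap (insertions n) (perms n)

-- countAdj R b σ : number of positions i (1-indexed, i ∈ [n-1]) with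
-- R σ(i) σ(i+1), restricted to positions of the parity selected by b;
-- the boolean flag b says whether the head position is counted.
countAdj : (ℕ → ℕ → Bool) → Bool → List ℕ → ℕ
countAdj R b [] = 0
countAdj R b (x ∷ []) = 0
countAdj R b (x ∷ y ∷ xs) =
  (if b ∧ R x y then 1 else 0) N.+ countAdj R (not b) (y ∷ xs)

_>ᵇ_ : ℕ → ℕ → Bool
m >ᵇ n = n <ᵇ m

-- descents at odd positions (positions start at 1, which is odd)
des₁ : List ℕ → ℕ
des₁ = countAdj _>ᵇ_ true

des₀ : List ℕ → ℕ
des₀ = countAdj _>ᵇ_ false

asc₀ : List ℕ → ℕ
asc₀ = countAdj _<ᵇ_ false

-- A_n(x,y) and Â_n(x,y) evaluated at integers x, y
A : ℕ → ℤ → ℤ → ℤ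
A n x y = ℤsum (map (λ σ → (x ^ des₁ σ) ℤ.* (y ^ des₀ σ)) (perms n))
  where
  ℤsum : List ℤ → ℤ
  ℤsum [] = + 0
  ℤsum (z ∷ zs) = z ℤ.+ ℤsum zs

Â : ℕ → ℤ → ℤ → ℤ
Â n x y = ℤsum (map (λ σ → (x ^ des₁ σ) ℤ.* (y ^ asc₀ σ)) (perms n))
  where
  ℤsum : List ℤ → ℤ
  ℤsum [] = + 0
  ℤsum (z ∷ zs) = z ℤ.+ ℤsum zs

isEven : ℕ → Bool
isEven zero = true
isEven (suc n) = not (isEven n)

Ã : ℕ → ℤ → ℤ → ℤ
Ã n x y = if isEven n then (+ 1 ℤ.+ y) ℤ.* A n x y else A n x y

Ā : ℕ → ℤ → ℤ → ℤ
Ā n x y = if isEven n then (+ 1 ℤ.+ y) ℤ.* Â n x y else Â n x y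

a : ℕ → ℕ → ℕ
a n j = length (filterᵇ (λ σ → (des₁ σ N.≡ᵇ j) ∧ (des₀ σ N.≡ᵇ 0)) (perms n))

ā : ℕ → ℕ → ℕ
ā n j = length (filterᵇ (λ σ → (des₁ σ N.≡ᵇ j) ∧ (asc₀ σ N.≡ᵇ 0)) (perms n))

gammaSum : (ℕ → ℕ → ℕ) → ℕ → ℤ → ℤ → ℤ
gammaSum c n x y = go (upTo (suc (n / 2)))
  where
  go : List ℕ → ℤ
  go [] = + 0
  go (j ∷ js) = ((+ c n j) ℤ.* ((x ℤ.+ y) ^ j)) ℤ.* ((+ 1 ℤ.+ x ℤ.* y) ^ (n / 2 ∸ j)) ℤ.+ go js

-- A permutation of length n+1 is determined by its last letter k and the
-- standardisation of its first n letters; appending k multiplies the weight x^des₁ y^des₀ by a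
-- factor that depends only on k, the previous last letter ℓ and the parity of the position.
-- Grouping permutations by their last letter, two appending steps act by an explicit kernel, and
-- induction shows that for even n the permutations ending in ℓ have total weight x·r(ℓ) + r(n-1-ℓ),
-- with r(ℓ) a homogeneous polynomial in u = 1+xy and v = x+y whose integer coefficients do not
-- depend on x and y. Summing over ℓ (after one more step when n is odd) expresses Ã_n as
-- Σ γ_j v^j u^(⌊n/2⌋-j). For Â_n the same computation runs with u and v exchanged and the same
-- coefficients, so its γ-vector is the reverse. Setting y = 0 gives u = 1 and v = x and identifies
-- γ_j with a(n,j), since a polynomial vanishing at every positive integer is zero.

{-# OPTIONS --safe #-}
module Submission where

open import Defs
open import Data.Nat as ℕ using (ℕ; zero; suc; _≡ᵇ_; _<ᵇ_; _≤_; _<_; _∸_; _⊔_; _⊓_; z≤n; s≤s; s≤s⁻¹; ⌊_/2⌋)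
open import Data.Nat.Properties
open import Data.Nat.Divisibility using (_∣_; ∣⇒≤; m∣m*n)
open import Data.Nat.DivMod using (_/_; m/n≡1+[m∸n]/n)
open import Data.Integer as ℤ using (ℤ; +_; 0ℤ; 1ℤ; -1ℤ; _+_; _*_; -_; _-_; _^_; ∣_∣)
import Data.Integer.Properties as ℤP
open import Data.Integer.Tactic.RingSolver using (solve-∀)
open import Data.Bool using (Bool; true; false; not; _∧_; if_then_else_; T)
open import Data.Bool.Properties using (not-involutive)
open import Data.List as L
  using (List; []; _∷_; map; _++_; concatMap; foldr; upTo; applyUpTo; _∷ʳ_; length; filterᵇ; initLast; _∷ʳ′_)
import Data.List.Properties as LP
open import Data.List.Membership.Propositional using (_∈_; _∉_; find; lose)
open import Data.List.Membership.Propositional.Properties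
open import Data.List.Membership.Propositional.Properties.WithK using (unique∧set⇒bag)
open import Data.List.Relation.Unary.Any using (here; there)
open import Data.List.Relation.Unary.All as All using (All; []; _∷_)
open import Data.List.Relation.Unary.AllPairs using ([]; _∷_)
open import Data.List.Relation.Unary.Unique.Propositional using (Unique)
import Data.List.Relation.Unary.Unique.Propositional.Properties as Unique
open import Data.List.Relation.Binary.BagAndSetEquality using (∼bag⇒↭)
open import Data.List.Relation.Binary.Permutation.Propositional using (_↭_; ↭-sym; ↭⇒↭ₛ)
open import Data.List.Relation.Binary.Permutation.Propositional.Properties using (shift; ∈-resp-↭; map⁺)
import Data.List.Relation.Binary.Permutation.Setoid.Properties as PermutationSetoid
open import Data.Product using (_×_; _,_; proj₁; proj₂; ∃-syntax)
open import Data.Sum using (inj₁; inj₂)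
open import Function using (_∘_; id; mk⇔)
open import Relation.Nullary using (¬_; yes; no; contradiction)
open import Relation.Nullary.Reflects using (ofʸ; ofⁿ)
open import Relation.Binary.PropositionalEquality

sumℤ : List ℤ → ℤ
sumℤ = foldr _+_ 0ℤ

sumℤ-++ : ∀ xs ys → sumℤ (xs ++ ys) ≡ sumℤ xs + sumℤ ys
sumℤ-++ []       ys = sym (ℤP.+-identityˡ _)
sumℤ-++ (x ∷ xs) ys = trans (cong (λ s → x + s) (sumℤ-++ xs ys)) (sym (ℤP.+-assoc x _ _))

sumℤ-↭ : ∀ {xs ys} → xs ↭ ys → sumℤ xs ≡ sumℤ ys
sumℤ-↭ p = PermutationSetoid.foldr-commMonoid (setoid ℤ) ℤP.+-0-isCommutativeMonoid (↭⇒↭ₛ p)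

sumℤ-unique : ∀ {A : Set} (s : List A → ℤ) (f : A → ℤ) → s [] ≡ 0ℤ →
              (∀ a as → s (a ∷ as) ≡ f a + s as) → ∀ as → s as ≡ sumℤ (map f as)
sumℤ-unique s f s[] s∷ []       = s[]
sumℤ-unique s f s[] s∷ (a ∷ as) = trans (s∷ a as) (cong (λ s → f a + s) (sumℤ-unique s f s[] s∷ as))

module _ {A : Set} (f : A → ℤ) where

  sumℤ-map-cong : ∀ {g : A → ℤ} xs → (∀ {x} → x ∈ xs → f x ≡ g x) → sumℤ (map f xs) ≡ sumℤ (map g xs)
  sumℤ-map-cong []       f≡g = refl
  sumℤ-map-cong (x ∷ xs) f≡g = cong₂ _+_ (f≡g (here refl)) (sumℤ-map-cong xs (f≡g ∘ there))

  sumℤ-concatMap : ∀ {B : Set} (g : B → List A) bs →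
                   sumℤ (map f (concatMap g bs)) ≡ sumℤ (map (λ b → sumℤ (map f (g b))) bs)
  sumℤ-concatMap g []       = refl
  sumℤ-concatMap g (b ∷ bs) = begin
    sumℤ (map f (g b ++ concatMap g bs))                 ≡⟨ cong sumℤ (LP.map-++ f (g b) _) ⟩
    sumℤ (map f (g b) ++ map f (concatMap g bs))         ≡⟨ sumℤ-++ (map f (g b)) _ ⟩
    sumℤ (map f (g b)) + sumℤ (map f (concatMap g bs))   ≡⟨ cong (λ s → sumℤ (map f (g b)) + s) (sumℤ-concatMap g bs) ⟩
    sumℤ (map f (g b)) + sumℤ (map (λ b → sumℤ (map f (g b))) bs) ∎
    where open ≡-Reasoning

Σ< : ℕ → (ℕ → ℤ) → ℤ
Σ< zero    f = 0ℤ
Σ< (suc N) f = Σ< N f + f N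

Σ<-cong-< : ∀ N {f g : ℕ → ℤ} → (∀ j → j < N → f j ≡ g j) → Σ< N f ≡ Σ< N g
Σ<-cong-< zero    f≡g = refl
Σ<-cong-< (suc N) f≡g = cong₂ _+_ (Σ<-cong-< N (λ j j<N → f≡g j (m<n⇒m<1+n j<N))) (f≡g N ≤-refl)

Σ<-cong : ∀ N {f g : ℕ → ℤ} → (∀ j → f j ≡ g j) → Σ< N f ≡ Σ< N g
Σ<-cong N f≡g = Σ<-cong-< N (λ j _ → f≡g j)

Σ<-+ : ∀ N (f g : ℕ → ℤ) → Σ< N (λ j → f j + g j) ≡ Σ< N f + Σ< N g
Σ<-+ zero    f g = refl
Σ<-+ (suc N) f g = trans (cong (_+ (f N + g N)) (Σ<-+ N f g)) (interchange (Σ< N f) (Σ< N g) (f N) (g N))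
  where
  interchange : ∀ (a b c d : ℤ) → (a + b) + (c + d) ≡ (a + c) + (b + d)
  interchange = solve-∀

Σ<-*ˡ : ∀ N (c : ℤ) (f : ℕ → ℤ) → Σ< N (λ j → c * f j) ≡ c * Σ< N f
Σ<-*ˡ zero    c f = sym (ℤP.*-zeroʳ c)
Σ<-*ˡ (suc N) c f = trans (cong (_+ c * f N) (Σ<-*ˡ N c f)) (sym (ℤP.*-distribˡ-+ c _ _))

Σ<-*ʳ : ∀ N (c : ℤ) (f : ℕ → ℤ) → Σ< N (λ j → f j * c) ≡ Σ< N f * c
Σ<-*ʳ N c f = trans (Σ<-cong N (λ j → ℤP.*-comm (f j) c)) (trans (Σ<-*ˡ N c f) (ℤP.*-comm c _))

Σ<-const : ∀ N (c : ℤ) → Σ< N (λ _ → c) ≡ + N * c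
Σ<-const zero    c = sym (ℤP.*-zeroˡ c)
Σ<-const (suc N) c = trans (cong (_+ c) (Σ<-const N c)) (step (+ N) c)
  where
  step : ∀ (a c : ℤ) → a * c + c ≡ (1ℤ + a) * c
  step = solve-∀

Σ<-zero : ∀ N {f : ℕ → ℤ} → (∀ j → j < N → f j ≡ 0ℤ) → Σ< N f ≡ 0ℤ
Σ<-zero N f≡0 = trans (Σ<-cong-< N f≡0) (trans (Σ<-const N 0ℤ) (ℤP.*-zeroʳ (+ N)))

Σ<-suc : ∀ N (f : ℕ → ℤ) → Σ< (suc N) f ≡ f 0 + Σ< N (f ∘ suc)
Σ<-suc zero    f = ℤP.+-comm 0ℤ (f 0)
Σ<-suc (suc N) f = trans (cong (_+ f (suc N)) (Σ<-suc N f)) (ℤP.+-assoc (f 0) _ _)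

Σ<-swap : ∀ N M (f : ℕ → ℕ → ℤ) → Σ< N (λ i → Σ< M (f i)) ≡ Σ< M (λ j → Σ< N (λ i → f i j))
Σ<-swap zero    M f = sym (Σ<-zero M (λ _ _ → refl))
Σ<-swap (suc N) M f =
  trans (cong (_+ Σ< M (f N)) (Σ<-swap N M f)) (sym (Σ<-+ M (λ j → Σ< N (λ i → f i j)) (f N)))

Σ<-reverse : ∀ N (f : ℕ → ℤ) → Σ< N (λ j → f (N ∸ suc j)) ≡ Σ< N f
Σ<-reverse zero    f = refl
Σ<-reverse (suc N) f =
  trans (Σ<-suc N (λ j → f (N ∸ j))) (trans (cong (λ s → f N + s) (Σ<-reverse N f)) (ℤP.+-comm (f N) _))

sumℤ-applyUpTo : ∀ (F : ℕ → ℤ) N (h : ℕ → ℕ) → sumℤ (map F (applyUpTo h N)) ≡ Σ< N (F ∘ h)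
sumℤ-applyUpTo F zero    h = refl
sumℤ-applyUpTo F (suc N) h =
  trans (cong (λ s → F (h 0) + s) (sumℤ-applyUpTo F N (h ∘ suc))) (sym (Σ<-suc N (F ∘ h)))

sumℤ-upTo : ∀ (F : ℕ → ℤ) N → sumℤ (map F (upTo N)) ≡ Σ< N F
sumℤ-upTo F N = sumℤ-applyUpTo F N id

Σ<-interchange : ∀ N M (a : ℕ → ℤ) (b : ℕ → ℕ → ℤ) (g : ℕ → ℤ) →
  Σ< N (λ i → a i * Σ< M (λ j → b i j * g j)) ≡ Σ< M (λ j → Σ< N (λ i → a i * b i j) * g j)
Σ<-interchange N M a b g = begin
  Σ< N (λ i → a i * Σ< M (λ j → b i j * g j))   ≡⟨ Σ<-cong N (λ i → sym (Σ<-*ˡ M (a i) _)) ⟩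
  Σ< N (λ i → Σ< M (λ j → a i * (b i j * g j))) ≡⟨ Σ<-swap N M _ ⟩
  Σ< M (λ j → Σ< N (λ i → a i * (b i j * g j)))
    ≡⟨ Σ<-cong M (λ j → Σ<-cong N (λ i → sym (ℤP.*-assoc (a i) _ _))) ⟩
  Σ< M (λ j → Σ< N (λ i → a i * b i j * g j))   ≡⟨ Σ<-cong M (λ j → Σ<-*ʳ N (g j) _) ⟩
  Σ< M (λ j → Σ< N (λ i → a i * b i j) * g j)   ∎
  where open ≡-Reasoning

∸-reflect-involutive : ∀ {n ℓ} → ℓ < n → n ∸ suc (n ∸ suc ℓ) ≡ ℓ
∸-reflect-involutive {suc n} (s≤s ℓ≤n) = m∸[m∸n]≡n ℓ≤n

Σ<-reflect : ∀ n (x : ℤ) (r F : ℕ → ℤ) →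
  Σ< n (λ ℓ → (x * r ℓ + r (n ∸ suc ℓ)) * F ℓ) ≡ Σ< n (λ ℓ → r ℓ * (x * F ℓ + F (n ∸ suc ℓ)))
Σ<-reflect n x r F = begin
  Σ< n (λ ℓ → (x * r ℓ + r (n ∸ suc ℓ)) * F ℓ)
    ≡⟨ Σ<-cong n (λ ℓ → expand x (r ℓ) (r (n ∸ suc ℓ)) (F ℓ)) ⟩
  Σ< n (λ ℓ → x * (r ℓ * F ℓ) + r (n ∸ suc ℓ) * F ℓ)
    ≡⟨ Σ<-+ n _ _ ⟩
  Σ< n (λ ℓ → x * (r ℓ * F ℓ)) + Σ< n (λ ℓ → r (n ∸ suc ℓ) * F ℓ)
    ≡⟨ cong (λ s → Σ< n (λ ℓ → x * (r ℓ * F ℓ)) + s) (begin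
         Σ< n (λ ℓ → r (n ∸ suc ℓ) * F ℓ)
           ≡⟨ Σ<-cong-< n (λ ℓ ℓ<n → cong (λ i → r (n ∸ suc ℓ) * F i) (∸-reflect-involutive ℓ<n)) ⟨
         Σ< n (λ ℓ → r (n ∸ suc ℓ) * F (n ∸ suc (n ∸ suc ℓ)))
           ≡⟨ Σ<-reverse n (λ ℓ → r ℓ * F (n ∸ suc ℓ)) ⟩
         Σ< n (λ ℓ → r ℓ * F (n ∸ suc ℓ)) ∎) ⟩
  Σ< n (λ ℓ → x * (r ℓ * F ℓ)) + Σ< n (λ ℓ → r ℓ * F (n ∸ suc ℓ))
    ≡⟨ Σ<-+ n _ _ ⟨
  Σ< n (λ ℓ → x * (r ℓ * F ℓ) + r ℓ * F (n ∸ suc ℓ))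
    ≡⟨ Σ<-cong n (λ ℓ → collect x (r ℓ) (F ℓ) (F (n ∸ suc ℓ))) ⟩
  Σ< n (λ ℓ → r ℓ * (x * F ℓ + F (n ∸ suc ℓ))) ∎
  where
  open ≡-Reasoning
  expand : ∀ (x a b c : ℤ) → (x * a + b) * c ≡ x * (a * c) + b * c
  expand = solve-∀
  collect : ∀ (x a b c : ℤ) → x * (a * b) + a * c ≡ a * (x * b + c)
  collect = solve-∀

<ᵇ-true : ∀ {m n} → m < n → (m <ᵇ n) ≡ true
<ᵇ-true {m} {n} m<n with m <ᵇ n | <ᵇ-reflects-< m n
... | true  | _        = refl
... | false | ofⁿ m≮n = contradiction m<n m≮n

<ᵇ-false : ∀ {m n} → n ≤ m → (m <ᵇ n) ≡ false
<ᵇ-false {m} {n} n≤m with m <ᵇ n | <ᵇ-reflects-< m n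
... | true  | ofʸ m<n = contradiction m<n (≤⇒≯ n≤m)
... | false | _       = refl

≡ᵇ-true : ∀ {m n} → m ≡ n → (m ≡ᵇ n) ≡ true
≡ᵇ-true {m} {n} m≡n with m ≡ᵇ n in eq
... | true  = refl
... | false = contradiction (≡⇒≡ᵇ m n m≡n) (subst T eq)

≡ᵇ-false : ∀ {m n} → m ≢ n → (m ≡ᵇ n) ≡ false
≡ᵇ-false {m} {n} m≢n with m ≡ᵇ n in eq
... | true  = contradiction (≡ᵇ⇒≡ m n (subst T (sym eq) _)) m≢n
... | false = refl

punchIn : ℕ → ℕ → ℕ
punchIn k v = if v <ᵇ k then v else suc v

punchOut : ℕ → ℕ → ℕ
punchOut k v = if v <ᵇ k then v else ℕ.pred v

punchOut-punchIn : ∀ k v → punchOut k (punchIn k v) ≡ v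
punchOut-punchIn k v with v <ᵇ k | <ᵇ-reflects-< v k
... | true  | ofʸ v<k rewrite <ᵇ-true v<k = refl
... | false | ofⁿ v≮k rewrite <ᵇ-false {suc v} (≤-trans (≮⇒≥ v≮k) (n≤1+n v)) = refl

punchIn-punchOut : ∀ k v → v ≢ k → punchIn k (punchOut k v) ≡ v
punchIn-punchOut k v v≢k with v <ᵇ k | <ᵇ-reflects-< v k
... | true  | ofʸ v<k rewrite <ᵇ-true v<k = refl
punchIn-punchOut k zero v≢k    | false | ofⁿ v≮k = contradiction (n≤0⇒n≡0 (≮⇒≥ v≮k)) (v≢k ∘ sym)
punchIn-punchOut k (suc v) v≢k | false | ofⁿ v≮k
  rewrite <ᵇ-false {v} (s≤s⁻¹ (≤∧≢⇒< (≮⇒≥ v≮k) (v≢k ∘ sym))) = refl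

punchIn≢ : ∀ k v → punchIn k v ≢ k
punchIn≢ k v with v <ᵇ k | <ᵇ-reflects-< v k
... | true  | ofʸ v<k = <⇒≢ v<k
... | false | ofⁿ v≮k = λ sv≡k → v≮k (≤-reflexive sv≡k)

punchIn-injective : ∀ k {u v} → punchIn k u ≡ punchIn k v → u ≡ v
punchIn-injective k {u} {v} eq =
  trans (sym (punchOut-punchIn k u)) (trans (cong (punchOut k) eq) (punchOut-punchIn k v))

punchIn-< : ∀ {n k v} → v < n → punchIn k v < suc n
punchIn-< {n} {k} {v} v<n with v <ᵇ k
... | true  = m<n⇒m<1+n v<n
... | false = s≤s v<n

punchOut-< : ∀ {n k v} → k ≤ n → v < suc n → v ≢ k → punchOut k v < n
punchOut-< {n} {k} {v} k≤n v<1+n v≢k with v <ᵇ k | <ᵇ-reflects-< v k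
... | true  | ofʸ v<k = <-≤-trans v<k k≤n
punchOut-< {v = zero}  k≤n v<1+n v≢k | false | ofⁿ v≮k = contradiction (sym (n≤0⇒n≡0 (≮⇒≥ v≮k))) v≢k
punchOut-< {v = suc v} k≤n v<1+n v≢k | false | _       = s≤s⁻¹ v<1+n

punchIn-<ᵇ : ∀ k u v → (punchIn k u <ᵇ punchIn k v) ≡ (u <ᵇ v)
punchIn-<ᵇ k u v with u <ᵇ k | <ᵇ-reflects-< u k | v <ᵇ k | <ᵇ-reflects-< v k
... | true  | _        | true  | _        = refl
... | false | _        | false | _        = refl
... | true  | ofʸ u<k | false | ofⁿ v≮k =
  trans (<ᵇ-true (<-≤-trans u<k (≤-trans (≮⇒≥ v≮k) (n≤1+n v)))) (sym (<ᵇ-true (<-≤-trans u<k (≮⇒≥ v≮k))))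
... | false | ofⁿ u≮k | true  | ofʸ v<k =
  trans (<ᵇ-false (≤-trans (<⇒≤ v<k) (≤-trans (≮⇒≥ u≮k) (n≤1+n u))))
        (sym (<ᵇ-false (≤-trans (<⇒≤ v<k) (≮⇒≥ u≮k))))

<ᵇ-punchIn : ∀ k ℓ → (k <ᵇ punchIn k ℓ) ≡ not (ℓ <ᵇ k)
<ᵇ-punchIn k ℓ with ℓ <ᵇ k | <ᵇ-reflects-< ℓ k
... | true  | ofʸ ℓ<k = <ᵇ-false (<⇒≤ ℓ<k)
... | false | ofⁿ ℓ≮k = <ᵇ-true (s≤s (≮⇒≥ ℓ≮k))

punchIn-<ᵇ-self : ∀ k ℓ → (punchIn k ℓ <ᵇ k) ≡ (ℓ <ᵇ k)
punchIn-<ᵇ-self k ℓ with ℓ <ᵇ k | <ᵇ-reflects-< ℓ k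
... | true  | ofʸ ℓ<k = <ᵇ-true ℓ<k
... | false | ofⁿ ℓ≮k = <ᵇ-false (≤-trans (≮⇒≥ ℓ≮k) (n≤1+n ℓ))

-- Permutations and appending a last letter

module _ {A : Set} {x : A} where

  ∈-removeMid : ∀ {z} as bs → z ∈ as ++ x ∷ bs → z ≢ x → z ∈ as ++ bs
  ∈-removeMid as bs z∈ z≢x with ∈-resp-↭ (shift x as bs) z∈
  ... | here z≡x = contradiction z≡x z≢x
  ... | there z∈′ = z∈′

  ∈-insertMid : ∀ {z} as bs → z ∈ as ++ bs → z ∈ as ++ x ∷ bs
  ∈-insertMid as bs z∈ = ∈-resp-↭ (↭-sym (shift x as bs)) (there z∈)

  Unique-removeMid : ∀ as bs → Unique (as ++ x ∷ bs) → Unique (x ∷ as ++ bs)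
  Unique-removeMid as bs u = PermutationSetoid.Unique-resp-↭ (setoid A) (↭⇒↭ₛ (shift x as bs)) u

  Unique-insertMid : ∀ as bs → Unique (x ∷ as ++ bs) → Unique (as ++ x ∷ bs)
  Unique-insertMid as bs u = PermutationSetoid.Unique-resp-↭ (setoid A) (↭⇒↭ₛ (↭-sym (shift x as bs))) u

Unique-∷ʳ⁻ : ∀ {A : Set} {x : A} xs → Unique (xs ∷ʳ x) → x ∉ xs × Unique xs
Unique-∷ʳ⁻ xs u with Unique-removeMid xs [] u
... | x∉ ∷ u′ = (λ x∈ → All.lookup x∉ (subst (_ ∈_) (sym (LP.++-identityʳ xs)) x∈) refl)
               , subst Unique (LP.++-identityʳ xs) u′

Unique-∷ : ∀ {A : Set} {x : A} {xs} → x ∉ xs → Unique xs → Unique (x ∷ xs)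
Unique-∷ x∉xs u = All.tabulate (λ y∈ x≡y → x∉xs (subst (_∈ _) (sym x≡y) y∈)) ∷ u

Unique-concatMap : ∀ {A B : Set} (f : A → List B) (r : B → A) xs → Unique xs →
                   (∀ {x} → x ∈ xs → Unique (f x)) → (∀ {x y} → x ∈ xs → y ∈ f x → r y ≡ x) →
                   Unique (concatMap f xs)
Unique-concatMap f r []       _          _     _       = []
Unique-concatMap f r (x ∷ xs) (x∉ ∷ u) uniqf retract =
  Unique.++⁺ (uniqf (here refl)) (Unique-concatMap f r xs u (uniqf ∘ there) (retract ∘ there)) disjoint
  where
  disjoint : ∀ {v} → ¬ (v ∈ f x × v ∈ concatMap f xs)
  disjoint (v∈fx , v∈rest) with find (∈-concatMap⁻ f {xs = xs} v∈rest)
  ... | x′ , x′∈ , v∈fx′ =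
    All.lookup x∉ x′∈ (trans (sym (retract (here refl) v∈fx)) (retract (there x′∈) v∈fx′))

record IsPerm (n : ℕ) (σ : List ℕ) : Set where
  constructor isPerm
  field
    unique  : Unique σ
    bounded : ∀ {v} → v ∈ σ → v < n
    covers  : ∀ {v} → v < n → v ∈ σ

∈-insertions⁻ : ∀ n τ {σ} → σ ∈ insertions n τ → ∃[ as ] ∃[ bs ] (τ ≡ as ++ bs × σ ≡ as ++ n ∷ bs)
∈-insertions⁻ n []       (here refl) = [] , [] , refl , refl
∈-insertions⁻ n (y ∷ ys) (here refl) = [] , y ∷ ys , refl , refl
∈-insertions⁻ n (y ∷ ys) (there σ∈) with ∈-map⁻ (y ∷_) σ∈
... | σ′ , σ′∈ , refl with ∈-insertions⁻ n ys σ′∈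
...   | as , bs , refl , refl = y ∷ as , bs , refl , refl

∈-insertions⁺ : ∀ n as bs → as ++ n ∷ bs ∈ insertions n (as ++ bs)
∈-insertions⁺ n []       []       = here refl
∈-insertions⁺ n []       (b ∷ bs) = here refl
∈-insertions⁺ n (a ∷ as) bs       = there (∈-map⁺ (a ∷_) (∈-insertions⁺ n as bs))

perms-isPerm : ∀ n {σ} → σ ∈ perms n → IsPerm n σ
perms-isPerm zero    (here refl) = isPerm [] (λ ()) (λ ())
perms-isPerm (suc n) σ∈ with find (∈-concatMap⁻ (insertions n) {xs = perms n} σ∈)
... | τ , τ∈ , σ∈ins with perms-isPerm n τ∈ | ∈-insertions⁻ n τ σ∈ins
...   | isPerm u bounded covers | as , bs , refl , refl =
  isPerm (Unique-insertMid as bs (Unique-∷ (λ n∈ → <-irrefl refl (bounded n∈)) u)) bounded′ covers′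
  where
  bounded′ : ∀ {v} → v ∈ as ++ n ∷ bs → v < suc n
  bounded′ {v} v∈ with v ℕ.≟ n
  ... | yes refl = ≤-refl
  ... | no v≢n   = m<n⇒m<1+n (bounded (∈-removeMid as bs v∈ v≢n))
  covers′ : ∀ {v} → v < suc n → v ∈ as ++ n ∷ bs
  covers′ {v} v<1+n with v ℕ.≟ n
  ... | yes refl = ∈-insert as
  ... | no v≢n   = ∈-insertMid as bs (covers (≤∧≢⇒< (s≤s⁻¹ v<1+n) v≢n))

isPerm⇒∈perms : ∀ n {σ} → IsPerm n σ → σ ∈ perms n
isPerm⇒∈perms zero    {[]}    _ = here refl
isPerm⇒∈perms zero    {v ∷ σ} p with IsPerm.bounded p (here refl)
... | ()
isPerm⇒∈perms (suc n) {σ} (isPerm u bounded covers) with ∈-∃++ (covers {n} ≤-refl)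
... | as , bs , refl with Unique-removeMid as bs u
...   | n∉ ∷ u′ =
  ∈-concatMap⁺ (insertions n) (lose (isPerm⇒∈perms n (isPerm u′ bounded′ covers′)) (∈-insertions⁺ n as bs))
  where
  bounded′ : ∀ {v} → v ∈ as ++ bs → v < n
  bounded′ v∈ = ≤∧≢⇒< (s≤s⁻¹ (bounded (∈-insertMid as bs v∈))) (λ v≡n → All.lookup n∉ v∈ (sym v≡n))
  covers′ : ∀ {v} → v < n → v ∈ as ++ bs
  covers′ v<n = ∈-removeMid as bs (covers (m<n⇒m<1+n v<n)) (<⇒≢ v<n)

perms-length : ∀ n {σ} → σ ∈ perms n → length σ ≡ n
perms-length zero    (here refl) = refl
perms-length (suc n) σ∈ with find (∈-concatMap⁻ (insertions n) {xs = perms n} σ∈)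
... | τ , τ∈ , σ∈ins with ∈-insertions⁻ n τ σ∈ins
...   | as , bs , refl , refl = begin
  length (as ++ n ∷ bs)          ≡⟨ LP.length-++ as ⟩
  length as ℕ.+ suc (length bs)  ≡⟨ +-suc (length as) (length bs) ⟩
  suc (length as ℕ.+ length bs)  ≡⟨ cong suc (LP.length-++ as) ⟨
  suc (length (as ++ bs))        ≡⟨ cong suc (perms-length n τ∈) ⟩
  suc n                          ∎
  where open ≡-Reasoning

delete : ℕ → List ℕ → List ℕ
delete n []       = []
delete n (v ∷ vs) = if v ≡ᵇ n then vs else v ∷ delete n vs

delete-insertions : ∀ n τ {σ} → n ∉ τ → σ ∈ insertions n τ → delete n σ ≡ τ
delete-insertions n []       _   (here refl) rewrite ≡ᵇ-true (refl {x = n}) = refl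
delete-insertions n (y ∷ ys) _   (here refl) rewrite ≡ᵇ-true (refl {x = n}) = refl
delete-insertions n (y ∷ ys) n∉ (there σ∈) with ∈-map⁻ (y ∷_) σ∈
... | σ′ , σ′∈ , refl rewrite ≡ᵇ-false {y} {n} (λ y≡n → n∉ (here (sym y≡n))) =
  cong (y ∷_) (delete-insertions n ys (n∉ ∘ there) σ′∈)

insertions-unique : ∀ n τ → n ∉ τ → Unique (insertions n τ)
insertions-unique n []       _  = [] ∷ []
insertions-unique n (y ∷ ys) n∉ =
  All.tabulate head∉ ∷ Unique.map⁺ (λ eq → proj₂ (LP.∷-injective eq)) (insertions-unique n ys (n∉ ∘ there))
  where
  head∉ : ∀ {σ} → σ ∈ map (y ∷_) (insertions n ys) → n ∷ y ∷ ys ≢ σ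
  head∉ σ∈ eq with ∈-map⁻ (y ∷_) σ∈
  ... | _ , _ , refl = n∉ (here (proj₁ (LP.∷-injective eq)))

∉-perms : ∀ n {τ} → τ ∈ perms n → n ∉ τ
∉-perms n τ∈ n∈ = <-irrefl refl (IsPerm.bounded (perms-isPerm n τ∈) n∈)

perms-unique : ∀ n → Unique (perms n)
perms-unique zero    = [] ∷ []
perms-unique (suc n) = Unique-concatMap (insertions n) (delete n) (perms n) (perms-unique n)
  (λ τ∈ → insertions-unique n _ (∉-perms n τ∈)) (λ τ∈ σ∈ → delete-insertions n _ (∉-perms n τ∈) σ∈)

lastLetter : List ℕ → ℕ
lastLetter []           = 0
lastLetter (x ∷ [])     = x
lastLetter (x ∷ y ∷ ys) = lastLetter (y ∷ ys)

dropLast : List ℕ → List ℕ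
dropLast []           = []
dropLast (x ∷ [])     = []
dropLast (x ∷ y ∷ ys) = x ∷ dropLast (y ∷ ys)

lastLetter-∷ʳ : ∀ xs k → lastLetter (xs ∷ʳ k) ≡ k
lastLetter-∷ʳ []           k = refl
lastLetter-∷ʳ (x ∷ [])     k = refl
lastLetter-∷ʳ (x ∷ y ∷ ys) k = lastLetter-∷ʳ (y ∷ ys) k

dropLast-∷ʳ : ∀ xs k → dropLast (xs ∷ʳ k) ≡ xs
dropLast-∷ʳ []           k = refl
dropLast-∷ʳ (x ∷ [])     k = refl
dropLast-∷ʳ (x ∷ y ∷ ys) k = cong (x ∷_) (dropLast-∷ʳ (y ∷ ys) k)

lastLetter-map : ∀ f x xs → lastLetter (map f (x ∷ xs)) ≡ f (lastLetter (x ∷ xs))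
lastLetter-map f x []       = refl
lastLetter-map f x (y ∷ ys) = lastLetter-map f y ys

-- The permutation of length n+1 ending in k whose first n letters are order-isomorphic to τ.
extend : ℕ → List ℕ → List ℕ
extend k τ = map (punchIn k) τ ∷ʳ k

restrict : List ℕ → List ℕ
restrict σ = map (punchOut (lastLetter σ)) (dropLast σ)

restrict-extend : ∀ k τ → restrict (extend k τ) ≡ τ
restrict-extend k τ rewrite lastLetter-∷ʳ (map (punchIn k) τ) k | dropLast-∷ʳ (map (punchIn k) τ) k =
  trans (sym (LP.map-∘ τ)) (trans (LP.map-cong (punchOut-punchIn k) τ) (LP.map-id τ))

extensions : ℕ → List ℕ → List (List ℕ)
extensions n τ = map (λ k → extend k τ) (upTo (suc n))

extensions-unique : ∀ n → Unique (concatMap (extensions n) (perms n))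
extensions-unique n = Unique-concatMap (extensions n) restrict (perms n) (perms-unique n)
  (λ {τ} _ → Unique.map⁺ (λ {k} {k′} → LP.∷ʳ-injectiveʳ (map (punchIn k) τ) (map (punchIn k′) τ))
                         (Unique.upTo⁺ (suc n)))
  restrict-extensions
  where
  restrict-extensions : ∀ {τ σ} → τ ∈ perms n → σ ∈ extensions n τ → restrict σ ≡ τ
  restrict-extensions {τ} _ σ∈ with ∈-map⁻ (λ k → extend k τ) σ∈
  ... | k , _ , refl = restrict-extend k τ

extend-isPerm : ∀ {n k τ} → k ≤ n → IsPerm n τ → IsPerm (suc n) (extend k τ)
extend-isPerm {n} {k} {τ} k≤n (isPerm u bounded covers) = isPerm unique′ bounded′ covers′
  where
  unique′ : Unique (map (punchIn k) τ ∷ʳ k)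
  unique′ = Unique.++⁺ (Unique.map⁺ (punchIn-injective k) u) ([] ∷ []) λ where
    (v∈ , here refl) → let u , _ , eq = ∈-map⁻ (punchIn k) v∈ in punchIn≢ k u (sym eq)
  bounded′ : ∀ {v} → v ∈ map (punchIn k) τ ∷ʳ k → v < suc n
  bounded′ v∈ with ∈-++⁻ (map (punchIn k) τ) v∈
  ... | inj₂ (here refl) = s≤s k≤n
  ... | inj₁ v∈′ with ∈-map⁻ (punchIn k) v∈′
  ...   | u , u∈ , refl = punchIn-< {k = k} (bounded u∈)
  covers′ : ∀ {v} → v < suc n → v ∈ map (punchIn k) τ ∷ʳ k
  covers′ {v} v<1+n with v ℕ.≟ k
  ... | yes refl = ∈-++⁺ʳ (map (punchIn k) τ) (here refl)
  ... | no v≢k   = ∈-++⁺ˡ (subst (_∈ map (punchIn k) τ) (punchIn-punchOut k v v≢k)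
                     (∈-map⁺ (punchIn k) (covers (punchOut-< k≤n v<1+n v≢k))))

∈-extensions⁻ : ∀ n {σ} → σ ∈ concatMap (extensions n) (perms n) → IsPerm (suc n) σ
∈-extensions⁻ n σ∈ with find (∈-concatMap⁻ (extensions n) {xs = perms n} σ∈)
... | τ , τ∈ , σ∈ext with ∈-map⁻ (λ k → extend k τ) σ∈ext
...   | k , k∈ , refl = extend-isPerm (s≤s⁻¹ (∈-upTo⁻ k∈)) (perms-isPerm n τ∈)

∈-extensions⁺ : ∀ n {σ} → IsPerm (suc n) σ → σ ∈ concatMap (extensions n) (perms n)
∈-extensions⁺ n {σ} (isPerm u bounded covers) with initLast σ
... | [] with covers {0} (s≤s z≤n)
...   | ()
∈-extensions⁺ n {σ} (isPerm u bounded covers) | ρ ∷ʳ′ k =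
  ∈-concatMap⁺ (extensions n) (lose τ∈ (subst (_∈ extensions n τ) (cong (_∷ʳ k) punchIn-τ)
    (∈-map⁺ (λ k → extend k τ) (∈-upTo⁺ (s≤s k≤n)))))
  where
  k≤n : k ≤ n
  k≤n = s≤s⁻¹ (bounded (∈-++⁺ʳ ρ (here refl)))
  k∉ρ : k ∉ ρ
  k∉ρ = proj₁ (Unique-∷ʳ⁻ ρ u)
  τ : List ℕ
  τ = map (punchOut k) ρ
  punchIn-τ : map (punchIn k) τ ≡ ρ
  punchIn-τ = trans (sym (LP.map-∘ ρ))
    (LP.map-id-local (All.tabulate (λ {v} v∈ → punchIn-punchOut k v (λ v≡k → k∉ρ (subst (_∈ ρ) v≡k v∈)))))
  τ∈ : τ ∈ perms n
  τ∈ = isPerm⇒∈perms n (isPerm unique′ bounded′ covers′)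
    where
    unique′ : Unique τ
    unique′ = Unique.map⁻ (subst Unique (sym punchIn-τ) (proj₂ (Unique-∷ʳ⁻ ρ u)))
    bounded′ : ∀ {v} → v ∈ τ → v < n
    bounded′ v∈ with ∈-map⁻ (punchOut k) v∈
    ... | u , u∈ , refl = punchOut-< k≤n (bounded (∈-++⁺ˡ u∈)) (λ u≡k → k∉ρ (subst (_∈ ρ) u≡k u∈))
    covers′ : ∀ {v} → v < n → v ∈ τ
    covers′ {v} v<n with ∈-++⁻ ρ (covers (punchIn-< {k = k} v<n))
    ... | inj₁ v∈ = subst (_∈ τ) (punchOut-punchIn k v) (∈-map⁺ (punchOut k) v∈)
    ... | inj₂ (here eq) = contradiction eq (punchIn≢ k v)

perms-suc-↭ : ∀ n → perms (suc n) ↭ concatMap (extensions n) (perms n)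
perms-suc-↭ n = ∼bag⇒↭ (unique∧set⇒bag (perms-unique (suc n)) (extensions-unique n)
  (mk⇔ (∈-extensions⁺ n ∘ perms-isPerm (suc n)) (isPerm⇒∈perms (suc n) ∘ ∈-extensions⁻ n)))

sumℤ-perms-suc : ∀ n (f : List ℕ → ℤ) →
  sumℤ (map f (perms (suc n))) ≡ sumℤ (map (λ τ → Σ< (suc n) (λ k → f (extend k τ))) (perms n))
sumℤ-perms-suc n f = begin
  sumℤ (map f (perms (suc n)))
    ≡⟨ sumℤ-↭ (map⁺ f (perms-suc-↭ n)) ⟩
  sumℤ (map f (concatMap (extensions n) (perms n)))
    ≡⟨ sumℤ-concatMap f (extensions n) (perms n) ⟩
  sumℤ (map (λ τ → sumℤ (map f (extensions n τ))) (perms n))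
    ≡⟨ sumℤ-map-cong _ (perms n) (λ {τ} _ → sum-extensions τ) ⟩
  sumℤ (map (λ τ → Σ< (suc n) (λ k → f (extend k τ))) (perms n)) ∎
  where
  open ≡-Reasoning
  sum-extensions : ∀ τ → sumℤ (map f (extensions n τ)) ≡ Σ< (suc n) (λ k → f (extend k τ))
  sum-extensions τ = trans (cong sumℤ (sym (LP.map-∘ {g = f} {f = λ k → extend k τ} (upTo (suc n)))))
                           (sumℤ-upTo (λ k → f (extend k τ)) (suc n))

indicator : Bool → ℕ
indicator c = if c then 1 else 0

-- The parity flag that countAdj carries j letters further on.
alternate : Bool → ℕ → Bool
alternate b zero    = b
alternate b (suc j) = alternate (not b) j

alternate-not : ∀ b j → alternate (not b) j ≡ not (alternate b j)
alternate-not b zero    = refl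
alternate-not b (suc j) = alternate-not (not b) j

countAdj-map : ∀ (R : ℕ → ℕ → Bool) (f : ℕ → ℕ) → (∀ u v → R (f u) (f v) ≡ R u v) →
               ∀ b xs → countAdj R b (map f xs) ≡ countAdj R b xs
countAdj-map R f R∘f b []           = refl
countAdj-map R f R∘f b (u ∷ [])     = refl
countAdj-map R f R∘f b (u ∷ v ∷ xs) =
  cong₂ (λ c m → indicator (b ∧ c) ℕ.+ m) (R∘f u v) (countAdj-map R f R∘f (not b) (v ∷ xs))

countAdj-∷ʳ : ∀ (R : ℕ → ℕ → Bool) b t ts k →
  countAdj R b ((t ∷ ts) ∷ʳ k) ≡ countAdj R b (t ∷ ts) ℕ.+ indicator (alternate b (length ts) ∧ R (lastLetter (t ∷ ts)) k)
countAdj-∷ʳ R b t []       k = +-identityʳ _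
countAdj-∷ʳ R b t (u ∷ us) k =
  trans (cong (indicator (b ∧ R t u) ℕ.+_) (countAdj-∷ʳ R (not b) u us k)) (sym (+-assoc (indicator (b ∧ R t u)) _ _))

countAdj-extend : ∀ (R : ℕ → ℕ → Bool) k → (∀ u v → R (punchIn k u) (punchIn k v) ≡ R u v) → ∀ b t ts →
  countAdj R b (extend k (t ∷ ts))
  ≡ countAdj R b (t ∷ ts) ℕ.+ indicator (alternate b (length ts) ∧ R (punchIn k (lastLetter (t ∷ ts))) k)
countAdj-extend R k R∘punchIn b t ts = begin
  countAdj R b (map (punchIn k) (t ∷ ts) ∷ʳ k)
    ≡⟨ countAdj-∷ʳ R b (punchIn k t) (map (punchIn k) ts) k ⟩
  countAdj R b (map (punchIn k) (t ∷ ts))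
    ℕ.+ indicator (alternate b (length (map (punchIn k) ts)) ∧ R (lastLetter (map (punchIn k) (t ∷ ts))) k)
    ≡⟨ cong₂ (λ m c → m ℕ.+ indicator c) (countAdj-map R (punchIn k) R∘punchIn b (t ∷ ts))
         (cong₂ (λ j ℓ → alternate b j ∧ R ℓ k) (LP.length-map (punchIn k) ts) (lastLetter-map (punchIn k) t ts)) ⟩
  countAdj R b (t ∷ ts) ℕ.+ indicator (alternate b (length ts) ∧ R (punchIn k (lastLetter (t ∷ ts))) k) ∎
  where open ≡-Reasoning

^-+-indicator : ∀ (z : ℤ) m c → z ^ (m ℕ.+ indicator c) ≡ z ^ m * (if c then z else 1ℤ)
^-+-indicator z m true  = trans (ℤP.^-distribˡ-+-* z m 1) (cong (z ^ m *_) (ℤP.*-identityʳ z))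
^-+-indicator z m false = trans (cong (z ^_) (+-identityʳ m)) (sym (ℤP.*-identityʳ _))

-- R is the relation counted at even positions: _>ᵇ_ for A_n and _<ᵇ_ for Â_n.
module Weights (R : ℕ → ℕ → Bool) (x y : ℤ) where

  weight : List ℕ → ℤ
  weight σ = x ^ des₁ σ * y ^ countAdj R false σ

  -- The flag says whether the new adjacency sits at an odd position.
  stepFactor : Bool → ℕ → ℕ → ℤ
  stepFactor true  ℓ k = if ℓ <ᵇ k then 1ℤ else x
  stepFactor false ℓ k = if R (punchIn k ℓ) k then y else 1ℤ

  lastSum : ℕ → (ℕ → ℤ) → ℤ
  lastSum n g = sumℤ (map (λ σ → weight σ * g (lastLetter σ)) (perms n))

  lastSum-const-1 : ∀ n → lastSum n (λ _ → 1ℤ) ≡ sumℤ (map weight (perms n))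
  lastSum-const-1 n = sumℤ-map-cong _ (perms n) (λ _ → ℤP.*-identityʳ _)

  module _ (R∘punchIn : ∀ k u v → R (punchIn k u) (punchIn k v) ≡ R u v) where

    weight-extend : ∀ k t ts →
      weight (extend k (t ∷ ts)) ≡ weight (t ∷ ts) * stepFactor (alternate true (length ts)) (lastLetter (t ∷ ts)) k
    weight-extend k t ts = begin
      x ^ des₁ (extend k (t ∷ ts)) * y ^ countAdj R false (extend k (t ∷ ts))
        ≡⟨ cong₂ (λ d e → x ^ d * y ^ e)
             (countAdj-extend _>ᵇ_ k (λ u v → punchIn-<ᵇ k v u) true t ts)
             (countAdj-extend R k (R∘punchIn k) false t ts) ⟩
      x ^ (des₁ (t ∷ ts) ℕ.+ indicator (p ∧ (k <ᵇ punchIn k ℓ)))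
        * y ^ (countAdj R false (t ∷ ts) ℕ.+ indicator (alternate false (length ts) ∧ R (punchIn k ℓ) k))
        ≡⟨ cong₂ _*_ (^-+-indicator x (des₁ (t ∷ ts)) (p ∧ (k <ᵇ punchIn k ℓ)))
                     (^-+-indicator y (countAdj R false (t ∷ ts)) (alternate false (length ts) ∧ R (punchIn k ℓ) k)) ⟩
      (X * (if p ∧ (k <ᵇ punchIn k ℓ) then x else 1ℤ))
        * (Y * (if alternate false (length ts) ∧ R (punchIn k ℓ) k then y else 1ℤ))
        ≡⟨ cong₂ (λ c q → (X * (if p ∧ c then x else 1ℤ)) * (Y * (if q ∧ R (punchIn k ℓ) k then y else 1ℤ)))
             (<ᵇ-punchIn k ℓ) (alternate-not true (length ts)) ⟩
      (X * (if p ∧ not (ℓ <ᵇ k) then x else 1ℤ)) * (Y * (if not p ∧ R (punchIn k ℓ) k then y else 1ℤ))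
        ≡⟨ by-parity p ⟩
      X * Y * stepFactor p ℓ k ∎
      where
      open ≡-Reasoning
      ℓ = lastLetter (t ∷ ts)
      p = alternate true (length ts)
      X = x ^ des₁ (t ∷ ts)
      Y = y ^ countAdj R false (t ∷ ts)
      regroup : ∀ (a b c d : ℤ) → (a * c) * (b * d) ≡ (a * b) * (c * d)
      regroup = solve-∀
      by-parity : ∀ p → (X * (if p ∧ not (ℓ <ᵇ k) then x else 1ℤ)) * (Y * (if not p ∧ R (punchIn k ℓ) k then y else 1ℤ))
                        ≡ X * Y * stepFactor p ℓ k
      by-parity true with ℓ <ᵇ k
      ... | true  = trans (regroup X Y 1ℤ 1ℤ) (cong (X * Y *_) (ℤP.*-identityʳ 1ℤ))
      ... | false = trans (regroup X Y x 1ℤ) (cong (X * Y *_) (ℤP.*-identityʳ x))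
      by-parity false with R (punchIn k ℓ) k
      ... | true  = trans (regroup X Y 1ℤ y) (cong (X * Y *_) (ℤP.*-identityˡ y))
      ... | false = trans (regroup X Y 1ℤ 1ℤ) (cong (X * Y *_) (ℤP.*-identityʳ 1ℤ))

    lastSum-step : ∀ n g →
      lastSum (suc (suc n)) g ≡ lastSum (suc n) (λ ℓ → Σ< (suc (suc n)) (λ k → stepFactor (alternate true n) ℓ k * g k))
    lastSum-step n g = trans (sumℤ-perms-suc (suc n) (λ σ → weight σ * g (lastLetter σ)))
      (sumℤ-map-cong _ (perms (suc n)) (λ {τ} τ∈ → extendSum τ (perms-length (suc n) τ∈)))
      where
      extendSum : ∀ τ → length τ ≡ suc n →
        Σ< (suc (suc n)) (λ k → weight (extend k τ) * g (lastLetter (extend k τ)))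
        ≡ weight τ * Σ< (suc (suc n)) (λ k → stepFactor (alternate true n) (lastLetter τ) k * g k)
      extendSum (t ∷ ts) refl = trans
        (Σ<-cong (suc (suc n)) λ k → trans
          (cong₂ _*_ (weight-extend k t ts) (cong g (lastLetter-∷ʳ (map (punchIn k) (t ∷ ts)) k)))
          (ℤP.*-assoc (weight (t ∷ ts)) _ (g k)))
        (Σ<-*ˡ (suc (suc n)) (weight (t ∷ ts)) _)

-- Homogeneous forms in two variables

Coeffs : Set
Coeffs = ℕ → ℤ

hom : ℕ → ℤ → ℤ → Coeffs → ℤ
hom zero    u v c = c 0
hom (suc d) u v c = c 0 * u ^ suc d + v * hom d u v (c ∘ suc)

hom-cong : ∀ d u v {c c′ : Coeffs} → (∀ j → j ≤ d → c j ≡ c′ j) → hom d u v c ≡ hom d u v c′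
hom-cong zero    u v c≡c′ = c≡c′ 0 z≤n
hom-cong (suc d) u v c≡c′ =
  cong₂ (λ a b → a * u ^ suc d + v * b) (c≡c′ 0 z≤n) (hom-cong d u v (λ j j≤d → c≡c′ (suc j) (s≤s j≤d)))

hom-+ : ∀ d u v (c c′ : Coeffs) → hom d u v (λ j → c j + c′ j) ≡ hom d u v c + hom d u v c′
hom-+ zero    u v c c′ = refl
hom-+ (suc d) u v c c′ =
  trans (cong (λ z → (c 0 + c′ 0) * u ^ suc d + v * z) (hom-+ d u v (c ∘ suc) (c′ ∘ suc)))
        (distrib (c 0) (c′ 0) (u ^ suc d) v (hom d u v (c ∘ suc)) (hom d u v (c′ ∘ suc)))
  where
  distrib : ∀ (a b U v h h′ : ℤ) → (a + b) * U + v * (h + h′) ≡ (a * U + v * h) + (b * U + v * h′)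
  distrib = solve-∀

hom-* : ∀ d u v (a : ℤ) (c : Coeffs) → hom d u v (λ j → a * c j) ≡ a * hom d u v c
hom-* zero    u v a c = refl
hom-* (suc d) u v a c =
  trans (cong (λ z → a * c 0 * u ^ suc d + v * z) (hom-* d u v a (c ∘ suc)))
        (distrib a (c 0) (u ^ suc d) v (hom d u v (c ∘ suc)))
  where
  distrib : ∀ (a b U v h : ℤ) → (a * b) * U + v * (a * h) ≡ a * (b * U + v * h)
  distrib = solve-∀

hom-zero : ∀ d u v → hom d u v (λ _ → 0ℤ) ≡ 0ℤ
hom-zero zero    u v = refl
hom-zero (suc d) u v = trans (cong (λ z → 0ℤ + v * z) (hom-zero d u v)) (trans (ℤP.+-identityˡ _) (ℤP.*-zeroʳ v))

hom-Σ< : ∀ d u v N (c : ℕ → Coeffs) → hom d u v (λ j → Σ< N (λ ℓ → c ℓ j)) ≡ Σ< N (λ ℓ → hom d u v (c ℓ))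
hom-Σ< d u v zero    c = hom-zero d u v
hom-Σ< d u v (suc N) c =
  trans (hom-+ d u v (λ j → Σ< N (λ ℓ → c ℓ j)) (c N)) (cong (_+ hom d u v (c N)) (hom-Σ< d u v N c))

padTop : ℕ → Coeffs → Coeffs
padTop d c j = if j <ᵇ suc d then c j else 0ℤ

shiftUp : Coeffs → Coeffs
shiftUp c zero    = 0ℤ
shiftUp c (suc j) = c j

hom-top-zero : ∀ d u v (c : Coeffs) → c (suc d) ≡ 0ℤ → hom (suc d) u v c ≡ u * hom d u v c
hom-top-zero zero    u v c c₁≡0 = trans (cong (λ z → c 0 * (u * 1ℤ) + v * z) c₁≡0) (regroup (c 0) u v)
  where
  regroup : ∀ (a u v : ℤ) → a * (u * 1ℤ) + v * 0ℤ ≡ u * a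
  regroup = solve-∀
hom-top-zero (suc d) u v c top≡0 =
  trans (cong (λ z → c 0 * u ^ suc (suc d) + v * z) (hom-top-zero d u v (c ∘ suc) top≡0))
        (regroup (c 0) u (u ^ suc d) v (hom d u v (c ∘ suc)))
  where
  regroup : ∀ (a u U v h : ℤ) → a * (u * U) + v * (u * h) ≡ u * (a * U + v * h)
  regroup = solve-∀

hom-padTop : ∀ d u v (c : Coeffs) → hom (suc d) u v (padTop d c) ≡ u * hom d u v c
hom-padTop d u v c =
  trans (hom-top-zero d u v (padTop d c) (cong (λ b → if b then c (suc d) else 0ℤ) (<ᵇ-false {suc d} ≤-refl)))
        (cong (u *_) (hom-cong d u v λ j j≤d → cong (λ b → if b then c j else 0ℤ) (<ᵇ-true (s≤s j≤d))))

hom-shiftUp : ∀ d u v (c : Coeffs) → hom (suc d) u v (shiftUp c) ≡ v * hom d u v c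
hom-shiftUp d u v c = ℤP.+-identityˡ (v * hom d u v c)

hom-as-Σ< : ∀ d u v (c : Coeffs) → hom d u v c ≡ Σ< (suc d) (λ j → c j * v ^ j * u ^ (d ∸ j))
hom-as-Σ< zero    u v c = unit (c 0)
  where
  unit : ∀ (a : ℤ) → a ≡ 0ℤ + a * 1ℤ * 1ℤ
  unit = solve-∀
hom-as-Σ< (suc d) u v c = begin
  c 0 * u ^ suc d + v * hom d u v (c ∘ suc)
    ≡⟨ cong (λ z → c 0 * u ^ suc d + v * z) (hom-as-Σ< d u v (c ∘ suc)) ⟩
  c 0 * u ^ suc d + v * Σ< (suc d) (λ j → c (suc j) * v ^ j * u ^ (d ∸ j))
    ≡⟨ cong (λ z → c 0 * u ^ suc d + z) (sym (Σ<-*ˡ (suc d) v _)) ⟩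
  c 0 * u ^ suc d + Σ< (suc d) (λ j → v * (c (suc j) * v ^ j * u ^ (d ∸ j)))
    ≡⟨ cong₂ _+_ (lead (c 0) (u ^ suc d)) (Σ<-cong (suc d) λ j → shuffle v (c (suc j)) (v ^ j) (u ^ (d ∸ j))) ⟩
  c 0 * 1ℤ * u ^ suc d + Σ< (suc d) (λ j → c (suc j) * (v * v ^ j) * u ^ (d ∸ j))
    ≡⟨ Σ<-suc (suc d) (λ j → c j * v ^ j * u ^ (suc d ∸ j)) ⟨
  Σ< (suc (suc d)) (λ j → c j * v ^ j * u ^ (suc d ∸ j)) ∎
  where
  open ≡-Reasoning
  lead : ∀ (a U : ℤ) → a * U ≡ a * 1ℤ * U
  lead = solve-∀
  shuffle : ∀ (v a V U : ℤ) → v * (a * V * U) ≡ a * (v * V) * U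
  shuffle = solve-∀

hom-reverse : ∀ d u v (c : Coeffs) → hom d u v c ≡ hom d v u (λ j → c (d ∸ j))
hom-reverse d u v c = begin
  hom d u v c
    ≡⟨ hom-as-Σ< d u v c ⟩
  Σ< (suc d) (λ j → c j * v ^ j * u ^ (d ∸ j))
    ≡⟨ Σ<-cong-< (suc d) (λ j j<1+d → reindex j (s≤s⁻¹ j<1+d)) ⟩
  Σ< (suc d) (λ j → c (d ∸ (d ∸ j)) * u ^ (d ∸ j) * v ^ (d ∸ (d ∸ j)))
    ≡⟨ Σ<-reverse (suc d) (λ j → c (d ∸ j) * u ^ j * v ^ (d ∸ j)) ⟩
  Σ< (suc d) (λ j → c (d ∸ j) * u ^ j * v ^ (d ∸ j))
    ≡⟨ hom-as-Σ< d v u (λ j → c (d ∸ j)) ⟨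
  hom d v u (λ j → c (d ∸ j)) ∎
  where
  open ≡-Reasoning
  swap : ∀ (a b e : ℤ) → a * b * e ≡ a * e * b
  swap = solve-∀
  reindex : ∀ j → j ≤ d → c j * v ^ j * u ^ (d ∸ j) ≡ c (d ∸ (d ∸ j)) * u ^ (d ∸ j) * v ^ (d ∸ (d ∸ j))
  reindex j j≤d rewrite m∸[m∸n]≡n j≤d = swap (c j) (v ^ j) (u ^ (d ∸ j))

divisible-by-all⇒0 : ∀ (c : ℤ) → (∀ q → suc q ∣ ∣ c ∣) → c ≡ 0ℤ
divisible-by-all⇒0 c divisible with ∣ c ∣ in ∣c∣≡ | divisible ∣ c ∣
... | zero  | _    = ℤP.∣i∣≡0⇒i≡0 ∣c∣≡
... | suc m | 2+m∣ = contradiction (∣⇒≤ 2+m∣) (n≮n (suc m))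

private
  +≡0⇒≡- : ∀ (a b : ℤ) → a + b ≡ 0ℤ → a ≡ - b
  +≡0⇒≡- a b a+b≡0 = trans (cancel a b) (trans (cong (_- b) a+b≡0) (ℤP.+-identityˡ (- b)))
    where
    cancel : ∀ (a b : ℤ) → a ≡ (a + b) - b
    cancel = solve-∀

hom-1-vanishing : ∀ d (c : Coeffs) → (∀ q → hom d 1ℤ (+ suc q) c ≡ 0ℤ) → ∀ j → j ≤ d → c j ≡ 0ℤ
hom-1-vanishing zero    c vanish .zero z≤n = vanish 0
hom-1-vanishing (suc d) c vanish = λ where
    zero    _         → c₀≡0
    (suc j) (s≤s j≤d) → hom-1-vanishing d (c ∘ suc) tail-vanishes j j≤d
  where
  Q : ℕ → ℤ
  Q q = hom d 1ℤ (+ suc q) (c ∘ suc)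
  split : ∀ q → c 0 + + suc q * Q q ≡ 0ℤ
  split q = trans (cong (λ z → z + + suc q * Q q) (sym (trans (cong (c 0 *_) (ℤP.^-zeroˡ (suc d))) (ℤP.*-identityʳ (c 0)))))
                  (vanish q)
  -- c 0 = -(q+1)·Q q for every q, so every positive integer divides c 0.
  c₀≡0 : c 0 ≡ 0ℤ
  c₀≡0 = divisible-by-all⇒0 (c 0) λ q →
    subst (suc q ∣_) (sym (trans (cong ∣_∣ (+≡0⇒≡- (c 0) _ (split q)))
                            (trans (ℤP.∣-i∣≡∣i∣ (+ suc q * Q q)) (ℤP.∣i*j∣≡∣i∣*∣j∣ (+ suc q) (Q q)))))
          (m∣m*n ∣ Q q ∣)
  tail-vanishes : ∀ q → Q q ≡ 0ℤ
  tail-vanishes q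
    with ℤP.i*j≡0⇒i≡0∨j≡0 (+ suc q) (trans (sym (ℤP.+-identityˡ _)) (subst (λ a → a + + suc q * Q q ≡ 0ℤ) c₀≡0 (split q)))
  ... | inj₂ Q≡0 = Q≡0

hom-1-injective : ∀ d (c c′ : Coeffs) → (∀ v → hom d 1ℤ v c ≡ hom d 1ℤ v c′) → ∀ j → j ≤ d → c j ≡ c′ j
hom-1-injective d c c′ agree j j≤d =
  trans (sym (difference (c j) (c′ j)))
        (trans (cong (_+ c′ j) (hom-1-vanishing d (λ t → c t + -1ℤ * c′ t) vanish j j≤d)) (ℤP.+-identityˡ (c′ j)))
  where
  difference : ∀ (a b : ℤ) → (a + -1ℤ * b) + b ≡ a
  difference = solve-∀
  cancel : ∀ (a : ℤ) → a + -1ℤ * a ≡ 0ℤ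
  cancel = solve-∀
  vanish : ∀ q → hom d 1ℤ (+ suc q) (λ t → c t + -1ℤ * c′ t) ≡ 0ℤ
  vanish q = begin
    hom d 1ℤ v (λ t → c t + -1ℤ * c′ t)     ≡⟨ hom-+ d 1ℤ v c (λ t → -1ℤ * c′ t) ⟩
    hom d 1ℤ v c + hom d 1ℤ v (λ t → -1ℤ * c′ t) ≡⟨ cong₂ _+_ (agree v) (hom-* d 1ℤ v -1ℤ c′) ⟩
    hom d 1ℤ v c′ + -1ℤ * hom d 1ℤ v c′     ≡⟨ cancel (hom d 1ℤ v c′) ⟩
    0ℤ ∎
    where open ≡-Reasoning; v = + suc q

-- Counting and the two-step kernel

atLeast : ℕ → ℕ → ℤ
atLeast c j = if j <ᵇ c then 0ℤ else 1ℤ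

countAtLeast : ℕ → ℕ → ℤ
countAtLeast N c = Σ< N (atLeast c)

countAtLeast-≥ : ∀ N c → N ≤ c → countAtLeast N c ≡ 0ℤ
countAtLeast-≥ N c N≤c = Σ<-zero N (λ j j<N → cong (λ b → if b then 0ℤ else 1ℤ) (<ᵇ-true (<-≤-trans j<N N≤c)))

countAtLeast-closed : ∀ N c → c ≤ N → countAtLeast N c ≡ + (N ∸ c)
countAtLeast-closed zero    zero    _   = refl
countAtLeast-closed zero    (suc c) ()
countAtLeast-closed (suc N) c c≤1+N with c ≤? N
... | yes c≤N = begin
  countAtLeast N c + atLeast c N
    ≡⟨ cong₂ _+_ (countAtLeast-closed N c c≤N) (cong (λ b → if b then 0ℤ else 1ℤ) (<ᵇ-false c≤N)) ⟩
  + (N ∸ c) + 1ℤ                  ≡⟨ ℤP.pos-+ (N ∸ c) 1 ⟨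
  + (N ∸ c ℕ.+ 1)                 ≡⟨ cong +_ (+-comm (N ∸ c) 1) ⟩
  + suc (N ∸ c)                   ≡⟨ cong +_ (+-∸-assoc 1 c≤N) ⟨
  + (suc N ∸ c)                   ∎
  where open ≡-Reasoning
... | no c≰N rewrite ≤-antisym c≤1+N (≰⇒> c≰N) =
  trans (cong₂ _+_ (countAtLeast-≥ N (suc N) (n≤1+n N)) (cong (λ b → if b then 0ℤ else 1ℤ) (<ᵇ-true {N} ≤-refl)))
        (cong +_ (sym (n∸n≡0 N)))

atLeast-* : ∀ a b j → atLeast a j * atLeast b j ≡ atLeast (a ⊔ b) j
atLeast-* a b j with j <ᵇ a | <ᵇ-reflects-< j a | j <ᵇ b | <ᵇ-reflects-< j b
... | true  | ofʸ j<a | _     | _        rewrite <ᵇ-true (<-≤-trans j<a (m≤m⊔n a b)) = refl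
... | false | _        | true  | ofʸ j<b rewrite <ᵇ-true (<-≤-trans j<b (m≤n⊔m a b)) = refl
... | false | ofⁿ j≮a | false | ofⁿ j≮b rewrite <ᵇ-false (⊔-lub (≮⇒≥ j≮a) (≮⇒≥ j≮b)) = refl

countAbove : ℕ → ℕ → ℕ → ℤ
countAbove N k ℓ = Σ< N (λ j → atLeast k j * atLeast (suc ℓ) j)

countAbove-closed : ∀ N k ℓ → k ⊔ suc ℓ ≤ N → countAbove N k ℓ ≡ + (N ∸ (k ⊔ suc ℓ))
countAbove-closed N k ℓ ≤N = trans (Σ<-cong N (atLeast-* k (suc ℓ))) (countAtLeast-closed N (k ⊔ suc ℓ) ≤N)

∸-⊔-+ : ∀ {N k u} → k ≤ N → u ≤ N → N ∸ (k ⊔ (N ∸ u)) ℕ.+ k ≡ N ⊓ (u ℕ.+ k)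
∸-⊔-+ {N} {k} {u} k≤N u≤N = begin
  N ∸ (k ⊔ (N ∸ u)) ℕ.+ k            ≡⟨ cong (ℕ._+ k) (∸-distribˡ-⊔-⊓ N k (N ∸ u)) ⟩
  (N ∸ k) ⊓ (N ∸ (N ∸ u)) ℕ.+ k      ≡⟨ cong (λ i → (N ∸ k) ⊓ i ℕ.+ k) (m∸[m∸n]≡n u≤N) ⟩
  (N ∸ k) ⊓ u ℕ.+ k                  ≡⟨ +-distribʳ-⊓ k (N ∸ k) u ⟩
  (N ∸ k ℕ.+ k) ⊓ (u ℕ.+ k)          ≡⟨ cong (_⊓ (u ℕ.+ k)) (m∸n+n≡m k≤N) ⟩
  N ⊓ (u ℕ.+ k)                      ∎
  where open ≡-Reasoning

-- Both sides equal min(n+1, k+ℓ+1).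
countAbove-reflect : ∀ n k ℓ → ℓ < n → k ≤ suc n →
  countAbove (suc n) k (n ∸ suc ℓ) + + k ≡ countAbove (suc n) (suc n ∸ k) ℓ + + suc ℓ
countAbove-reflect n k ℓ ℓ<n k≤N = begin
  countAbove N k (n ∸ suc ℓ) + + k
    ≡⟨ cong (_+ + k) (countAbove-closed N k (n ∸ suc ℓ)
         (⊔-lub k≤N (≤-trans (≤-reflexive 1+n∸1+ℓ) (m∸n≤m N (suc ℓ))))) ⟩
  + (N ∸ (k ⊔ suc (n ∸ suc ℓ))) + + k
    ≡⟨ ℤP.pos-+ _ k ⟨
  + (N ∸ (k ⊔ suc (n ∸ suc ℓ)) ℕ.+ k)
    ≡⟨ cong (λ i → + (N ∸ (k ⊔ i) ℕ.+ k)) 1+n∸1+ℓ ⟩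
  + (N ∸ (k ⊔ (N ∸ suc ℓ)) ℕ.+ k)
    ≡⟨ cong +_ (∸-⊔-+ k≤N ℓ<N) ⟩
  + (N ⊓ (suc ℓ ℕ.+ k))
    ≡⟨ cong (λ i → + (N ⊓ i)) (+-comm (suc ℓ) k) ⟩
  + (N ⊓ (k ℕ.+ suc ℓ))
    ≡⟨ cong +_ (∸-⊔-+ ℓ<N k≤N) ⟨
  + (N ∸ (suc ℓ ⊔ (N ∸ k)) ℕ.+ suc ℓ)
    ≡⟨ cong (λ i → + (N ∸ i ℕ.+ suc ℓ)) (⊔-comm (suc ℓ) (N ∸ k)) ⟩
  + (N ∸ ((N ∸ k) ⊔ suc ℓ) ℕ.+ suc ℓ)
    ≡⟨ ℤP.pos-+ _ (suc ℓ) ⟩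
  + (N ∸ ((N ∸ k) ⊔ suc ℓ)) + + suc ℓ
    ≡⟨ cong (_+ + suc ℓ) (countAbove-closed N (N ∸ k) ℓ (⊔-lub (m∸n≤m N k) ℓ<N)) ⟨
  countAbove N (N ∸ k) ℓ + + suc ℓ ∎
  where
  open ≡-Reasoning
  N = suc n
  ℓ<N : suc ℓ ≤ N
  ℓ<N = m<n⇒m<1+n ℓ<n
  1+n∸1+ℓ : suc (n ∸ suc ℓ) ≡ n ∸ ℓ
  1+n∸1+ℓ = sym (+-∸-assoc 1 ℓ<n)

countAtLeast-above : ∀ {n ℓ} → ℓ < n → countAtLeast (suc n) (suc ℓ) ≡ + (n ∸ ℓ)
countAtLeast-above {n} {ℓ} ℓ<n = countAtLeast-closed (suc n) (suc ℓ) (s≤s (<⇒≤ ℓ<n))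

countAtLeast-reflect : ∀ {n ℓ} → ℓ < n → countAtLeast (suc n) (suc (n ∸ suc ℓ)) ≡ + suc ℓ
countAtLeast-reflect {n} {ℓ} ℓ<n = begin
  countAtLeast (suc n) (suc (n ∸ suc ℓ))  ≡⟨ cong (countAtLeast (suc n)) (+-∸-assoc 1 ℓ<n) ⟨
  countAtLeast (suc n) (n ∸ ℓ)            ≡⟨ countAtLeast-closed (suc n) (n ∸ ℓ) (≤-trans (m∸n≤m n ℓ) (n≤1+n n)) ⟩
  + (suc n ∸ (n ∸ ℓ))                     ≡⟨ cong +_ (+-∸-assoc 1 (m∸n≤m n ℓ)) ⟩
  + suc (n ∸ (n ∸ ℓ))                     ≡⟨ cong (λ i → + suc i) (m∸[m∸n]≡n (<⇒≤ ℓ<n)) ⟩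
  + suc ℓ                                 ∎
  where open ≡-Reasoning

countAtLeast-complement : ∀ {N k} → k ≤ N → countAtLeast N (N ∸ k) ≡ + k
countAtLeast-complement {N} {k} k≤N = trans (countAtLeast-closed N (N ∸ k) (m∸n≤m N k)) (cong +_ (m∸[m∸n]≡n k≤N))

module Kernel (x e₀ e₁ : ℤ) where

  evenFactor : ℕ → ℕ → ℤ
  evenFactor ℓ j = if ℓ <ᵇ j then e₁ else e₀

  oddFactor : ℕ → ℕ → ℤ
  oddFactor j k = if j <ᵇ k then 1ℤ else x

  evenFactor-atLeast : ∀ ℓ j → evenFactor ℓ j ≡ e₀ + atLeast (suc ℓ) j * (e₁ - e₀)
  evenFactor-atLeast ℓ j with ℓ <ᵇ j | <ᵇ-reflects-< ℓ j
  ... | true  | ofʸ ℓ<j rewrite <ᵇ-false {j} ℓ<j = high e₀ e₁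
    where
    high : ∀ (e₀ e₁ : ℤ) → e₁ ≡ e₀ + 1ℤ * (e₁ - e₀)
    high = solve-∀
  ... | false | ofⁿ ℓ≮j rewrite <ᵇ-true {j} (s≤s (≮⇒≥ ℓ≮j)) = low e₀ e₁
    where
    low : ∀ (e₀ e₁ : ℤ) → e₀ ≡ e₀ + 0ℤ * (e₁ - e₀)
    low = solve-∀

  oddFactor-atLeast : ∀ j k → oddFactor j k ≡ 1ℤ + atLeast k j * (x - 1ℤ)
  oddFactor-atLeast j k with j <ᵇ k
  ... | true  = low x
    where
    low : ∀ (x : ℤ) → 1ℤ ≡ 1ℤ + 0ℤ * (x - 1ℤ)
    low = solve-∀
  ... | false = high x
    where
    high : ∀ (x : ℤ) → x ≡ 1ℤ + 1ℤ * (x - 1ℤ)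
    high = solve-∀

  private
    affine-Σ< : ∀ N ℓ →
      Σ< N (λ j → e₀ + atLeast (suc ℓ) j * (e₁ - e₀)) ≡ + N * e₀ + countAtLeast N (suc ℓ) * (e₁ - e₀)
    affine-Σ< N ℓ = trans (Σ<-+ N _ _) (cong₂ _+_ (Σ<-const N e₀) (Σ<-*ʳ N _ _))

  evenFactor-Σ< : ∀ N ℓ → Σ< N (evenFactor ℓ) ≡ + N * e₀ + countAtLeast N (suc ℓ) * (e₁ - e₀)
  evenFactor-Σ< N ℓ = trans (Σ<-cong N (evenFactor-atLeast ℓ)) (affine-Σ< N ℓ)

  -- Two consecutive appended letters: first j after ℓ at an even position, then k after j.
  kernel : ℕ → ℕ → ℕ → ℤ
  kernel N k ℓ = Σ< N (λ j → evenFactor ℓ j * oddFactor j k)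

  kernel-closed : ∀ N k ℓ → kernel N k ℓ ≡ + N * e₀ + countAtLeast N (suc ℓ) * (e₁ - e₀)
                    + countAtLeast N k * (e₀ * (x - 1ℤ)) + countAbove N k ℓ * ((e₁ - e₀) * (x - 1ℤ))
  kernel-closed N k ℓ = begin
    kernel N k ℓ
      ≡⟨ Σ<-cong N (λ j → trans (cong₂ _*_ (evenFactor-atLeast ℓ j) (oddFactor-atLeast j k)) (expand (χℓ j) (χk j))) ⟩
    Σ< N (λ j → e₀ + χℓ j * E + χk j * F + χk j * χℓ j * G)
      ≡⟨ Σ<-+ N _ _ ⟩
    Σ< N (λ j → e₀ + χℓ j * E + χk j * F) + Σ< N (λ j → χk j * χℓ j * G)
      ≡⟨ cong₂ _+_ (Σ<-+ N _ _) (Σ<-*ʳ N G _) ⟩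
    Σ< N (λ j → e₀ + χℓ j * E) + Σ< N (λ j → χk j * F) + countAbove N k ℓ * G
      ≡⟨ cong₂ (λ s t → s + t + countAbove N k ℓ * G) (affine-Σ< N ℓ) (Σ<-*ʳ N F _) ⟩
    + N * e₀ + countAtLeast N (suc ℓ) * E + countAtLeast N k * F + countAbove N k ℓ * G ∎
    where
    open ≡-Reasoning
    χℓ = atLeast (suc ℓ)
    χk = atLeast k
    E = e₁ - e₀
    F = e₀ * (x - 1ℤ)
    G = (e₁ - e₀) * (x - 1ℤ)
    expand : ∀ α β → (e₀ + α * E) * (1ℤ + β * (x - 1ℤ)) ≡ e₀ + α * E + β * F + β * α * G
    expand α β = identity e₀ e₁ x α β
      where
      identity : ∀ (e₀ e₁ x α β : ℤ) → (e₀ + α * (e₁ - e₀)) * (1ℤ + β * (x - 1ℤ))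
                 ≡ e₀ + α * (e₁ - e₀) + β * (e₀ * (x - 1ℤ)) + β * α * ((e₁ - e₀) * (x - 1ℤ))
      identity = solve-∀

-- The γ-vectors

oddLen : ℕ → ℕ
oddLen zero    = 1
oddLen (suc m) = suc (suc (oddLen m))

evenLen : ℕ → ℕ
evenLen m = suc (oddLen m)

alternate-oddLen : ∀ m b → alternate b (oddLen m) ≡ not b
alternate-oddLen zero    b = refl
alternate-oddLen (suc m) b = trans (alternate-oddLen m (not (not b))) (cong not (not-involutive b))

alternate-evenLen : ∀ m b → alternate b (evenLen m) ≡ b
alternate-evenLen m b = trans (alternate-oddLen m (not b)) (not-involutive b)

-- With r ℓ the value of refinedγ m ℓ at (u, v), the permutations of length 2m+2 ending in ℓ
-- have total weight x · r ℓ + r (2m+1-ℓ) (lastSum-evenLen); the recursion comes from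
-- appending two letters (kernel-reflect).
refinedγ : ℕ → ℕ → Coeffs
refinedγ zero    zero    _ = 1ℤ
refinedγ zero    (suc _) _ = 0ℤ
refinedγ (suc m) k       t = Σ< (evenLen m) λ ℓ →
  (countAtLeast (suc (evenLen m)) k - countAbove (suc (evenLen m)) k ℓ) * padTop m (refinedγ m ℓ) t
  + countAbove (suc (evenLen m)) k ℓ * shiftUp (refinedγ m ℓ) t

γEven : ℕ → Coeffs
γEven m t = Σ< (evenLen m) (λ ℓ → padTop m (refinedγ m ℓ) t + shiftUp (refinedγ m ℓ) t)

γOdd : ℕ → Coeffs
γOdd m t = Σ< (evenLen m) (λ ℓ → + suc ℓ * padTop m (refinedγ m ℓ) t + + (evenLen m ∸ ℓ) * shiftUp (refinedγ m ℓ) t)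

hom-refinedγ-suc : ∀ m k u v → hom (suc m) u v (refinedγ (suc m) k)
  ≡ Σ< (evenLen m) (λ ℓ → hom m u v (refinedγ m ℓ)
                          * (countAtLeast (suc (evenLen m)) k * u + countAbove (suc (evenLen m)) k ℓ * (v - u)))
hom-refinedγ-suc m k u v =
  trans (hom-Σ< (suc m) u v (evenLen m) (λ ℓ t → D ℓ * padTop m (ρ ℓ) t + M ℓ * shiftUp (ρ ℓ) t))
        (Σ<-cong (evenLen m) λ ℓ → begin
  hom (suc m) u v (λ t → D ℓ * padTop m (ρ ℓ) t + M ℓ * shiftUp (ρ ℓ) t)
    ≡⟨ hom-+ (suc m) u v (λ t → D ℓ * padTop m (ρ ℓ) t) (λ t → M ℓ * shiftUp (ρ ℓ) t) ⟩
  hom (suc m) u v (λ t → D ℓ * padTop m (ρ ℓ) t) + hom (suc m) u v (λ t → M ℓ * shiftUp (ρ ℓ) t)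
    ≡⟨ cong₂ _+_ (hom-* (suc m) u v (D ℓ) (padTop m (ρ ℓ))) (hom-* (suc m) u v (M ℓ) (shiftUp (ρ ℓ))) ⟩
  D ℓ * hom (suc m) u v (padTop m (ρ ℓ)) + M ℓ * hom (suc m) u v (shiftUp (ρ ℓ))
    ≡⟨ cong₂ (λ p s → D ℓ * p + M ℓ * s) (hom-padTop m u v (ρ ℓ)) (hom-shiftUp m u v (ρ ℓ)) ⟩
  D ℓ * (u * r ℓ) + M ℓ * (v * r ℓ)
    ≡⟨ collect (countAtLeast N k) (M ℓ) u v (r ℓ) ⟩
  r ℓ * (countAtLeast N k * u + M ℓ * (v - u)) ∎)
  where
  open ≡-Reasoning
  N = suc (evenLen m)
  ρ = refinedγ m
  r = λ ℓ → hom m u v (ρ ℓ)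
  M = countAbove N k
  D = λ ℓ → countAtLeast N k - M ℓ
  collect : ∀ (C M u v r : ℤ) → (C - M) * (u * r) + M * (v * r) ≡ r * (C * u + M * (v - u))
  collect = solve-∀

-- The two instances differ only in (e₀, e₁), the factors of a non-ascent / ascent at an even
-- position, and in (u, v): for A_n they are (y, 1) and (1+xy, x+y), for Â_n (1, y) and (x+y, 1+xy).
module Recurrence
  (R : ℕ → ℕ → Bool) (R∘punchIn : ∀ k a b → R (punchIn k a) (punchIn k b) ≡ R a b)
  (x y u v e₀ e₁ : ℤ)
  (stepFactor-even : ∀ ℓ j → Weights.stepFactor R x y false ℓ j ≡ Kernel.evenFactor x e₀ e₁ ℓ j)
  (kernel-identity : ∀ (A B K M₁ M₃ : ℤ) →
     x * ((A + B) * e₀ + B * (e₁ - e₀) + ((A + B) - K) * (e₀ * (x - 1ℤ)) + M₁ * ((e₁ - e₀) * (x - 1ℤ)))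
     + ((A + B) * e₀ + A * (e₁ - e₀) + ((A + B) - K) * (e₀ * (x - 1ℤ)) + (M₃ + A - K) * ((e₁ - e₀) * (x - 1ℤ)))
     ≡ x * (((A + B) - K) * u + M₁ * (v - u)) + (K * u + M₃ * (v - u)))
  (odd-identity : ∀ (A B : ℤ) → x * ((A + B) * e₀ + B * (e₁ - e₀)) + ((A + B) * e₀ + A * (e₁ - e₀)) ≡ A * u + B * v)
  (u+v : u + v ≡ (1ℤ + y) * (1ℤ + x))
  where

  open Weights R x y
  open Kernel x e₀ e₁

  r : ℕ → ℕ → ℤ
  r m ℓ = hom m u v (refinedγ m ℓ)

  transfer : ℕ → ℕ → ℕ → ℤ
  transfer n k ℓ = countAtLeast (suc n) k * u + countAbove (suc n) k ℓ * (v - u)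

  lastSum-cong : ∀ n {g g′ : ℕ → ℤ} → (∀ ℓ → g ℓ ≡ g′ ℓ) → lastSum n g ≡ lastSum n g′
  lastSum-cong n g≡g′ = sumℤ-map-cong _ (perms n) (λ {σ} _ → cong (weight σ *_) (g≡g′ (lastLetter σ)))

  lastSum-step′ : ∀ n b → alternate true n ≡ b → ∀ g →
    lastSum (suc (suc n)) g ≡ lastSum (suc n) (λ ℓ → Σ< (suc (suc n)) (λ k → stepFactor b ℓ k * g k))
  lastSum-step′ n _ refl = lastSum-step R∘punchIn n

  private
    pos-∸ : ∀ {a b} → b ≤ a → + (a ∸ b) ≡ + a - + b
    pos-∸ {a} {b} b≤a = trans (sym (ℤP.⊖-≥ b≤a)) (sym (ℤP.m-n≡m⊖n a b))

    split-length : ∀ {n ℓ} → ℓ < n → + suc n ≡ + suc ℓ + + (n ∸ ℓ)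
    split-length {n} {ℓ} ℓ<n =
      sym (trans (sym (ℤP.pos-+ (suc ℓ) (n ∸ ℓ))) (cong (λ i → + suc i) (m+[n∸m]≡n (<⇒≤ ℓ<n))))

    kernel-identity-at : ∀ {N cℓ cℓ′ cK cK′ M₁ M₂ M₃ : ℤ} (A B K : ℤ) →
      N ≡ A + B → cℓ ≡ B → cℓ′ ≡ A → cK ≡ (A + B) - K → cK′ ≡ K → M₂ ≡ M₃ + A - K →
      x * (N * e₀ + cℓ * (e₁ - e₀) + cK * (e₀ * (x - 1ℤ)) + M₁ * ((e₁ - e₀) * (x - 1ℤ)))
      + (N * e₀ + cℓ′ * (e₁ - e₀) + cK * (e₀ * (x - 1ℤ)) + M₂ * ((e₁ - e₀) * (x - 1ℤ)))
      ≡ x * (cK * u + M₁ * (v - u)) + (cK′ * u + M₃ * (v - u))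
    kernel-identity-at {M₁ = M₁} {M₃ = M₃} A B K refl refl refl refl refl refl = kernel-identity A B K M₁ M₃

    odd-identity-at : ∀ {N cℓ cℓ′ : ℤ} (A B : ℤ) → N ≡ A + B → cℓ ≡ B → cℓ′ ≡ A →
      x * (N * e₀ + cℓ * (e₁ - e₀)) + (N * e₀ + cℓ′ * (e₁ - e₀)) ≡ A * u + B * v
    odd-identity-at A B refl refl refl = odd-identity A B

    move : ∀ (a b c : ℤ) → a + b ≡ c → a ≡ c - b
    move a b c eq = trans (cancel a b) (cong (_- b) eq)
      where
      cancel : ∀ (a b : ℤ) → a ≡ (a + b) - b
      cancel = solve-∀

  kernel-reflect : ∀ n k ℓ → ℓ < n → k ≤ suc n →
    x * kernel (suc n) k ℓ + kernel (suc n) k (n ∸ suc ℓ) ≡ x * transfer n k ℓ + transfer n (suc n ∸ k) ℓ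
  kernel-reflect n k ℓ ℓ<n k≤N =
    trans (cong₂ (λ a b → x * a + b) (kernel-closed N k ℓ) (kernel-closed N k (n ∸ suc ℓ)))
          (kernel-identity-at {M₁ = countAbove N k ℓ} {M₂ = countAbove N k (n ∸ suc ℓ)} {M₃ = countAbove N (N ∸ k) ℓ}
            (+ suc ℓ) (+ (n ∸ ℓ)) (+ k)
            (split-length ℓ<n) (countAtLeast-above ℓ<n) (countAtLeast-reflect ℓ<n)
            (trans (countAtLeast-closed N k k≤N) (trans (pos-∸ k≤N) (cong (_- + k) (split-length ℓ<n))))
            (countAtLeast-complement k≤N)
            (move (countAbove N k (n ∸ suc ℓ)) (+ k) _ (countAbove-reflect n k ℓ ℓ<n k≤N)))
    where N = suc n

  two-steps : ∀ m (g : ℕ → ℤ) → let n = evenLen m; N = suc n in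
    Σ< n (λ ℓ → (x * r m ℓ + r m (n ∸ suc ℓ)) * Σ< N (λ j → evenFactor ℓ j * Σ< (suc N) (λ k → oddFactor j k * g k)))
    ≡ Σ< (suc N) (λ k → (x * r (suc m) k + r (suc m) (N ∸ k)) * g k)
  two-steps m g = begin
    Σ< n (λ ℓ → c ℓ * Σ< N (λ j → evenFactor ℓ j * Σ< (suc N) (λ k → oddFactor j k * g k)))
      ≡⟨ Σ<-cong n (λ ℓ → cong (c ℓ *_) (Σ<-interchange N (suc N) (evenFactor ℓ) oddFactor g)) ⟩
    Σ< n (λ ℓ → c ℓ * Σ< (suc N) (λ k → kernel N k ℓ * g k))
      ≡⟨ Σ<-interchange n (suc N) c (λ ℓ k → kernel N k ℓ) g ⟩
    Σ< (suc N) (λ k → Σ< n (λ ℓ → c ℓ * kernel N k ℓ) * g k)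
      ≡⟨ Σ<-cong-< (suc N) (λ k k<2+n → cong (_* g k) (per-letter k (s≤s⁻¹ k<2+n))) ⟩
    Σ< (suc N) (λ k → (x * r (suc m) k + r (suc m) (N ∸ k)) * g k) ∎
    where
    open ≡-Reasoning
    n = evenLen m
    N = suc n
    c = λ ℓ → x * r m ℓ + r m (n ∸ suc ℓ)
    per-letter : ∀ k → k ≤ N → Σ< n (λ ℓ → c ℓ * kernel N k ℓ) ≡ x * r (suc m) k + r (suc m) (N ∸ k)
    per-letter k k≤N = begin
      Σ< n (λ ℓ → c ℓ * kernel N k ℓ)
        ≡⟨ Σ<-reflect n x (r m) (λ ℓ → kernel N k ℓ) ⟩
      Σ< n (λ ℓ → r m ℓ * (x * kernel N k ℓ + kernel N k (n ∸ suc ℓ)))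
        ≡⟨ Σ<-cong-< n (λ ℓ ℓ<n → cong (r m ℓ *_) (kernel-reflect n k ℓ ℓ<n k≤N)) ⟩
      Σ< n (λ ℓ → r m ℓ * (x * transfer n k ℓ + transfer n (N ∸ k) ℓ))
        ≡⟨ Σ<-cong n (λ ℓ → distrib x (r m ℓ) (transfer n k ℓ) (transfer n (N ∸ k) ℓ)) ⟩
      Σ< n (λ ℓ → x * (r m ℓ * transfer n k ℓ) + r m ℓ * transfer n (N ∸ k) ℓ)
        ≡⟨ Σ<-+ n _ _ ⟩
      Σ< n (λ ℓ → x * (r m ℓ * transfer n k ℓ)) + Σ< n (λ ℓ → r m ℓ * transfer n (N ∸ k) ℓ)
        ≡⟨ cong₂ _+_ (trans (Σ<-*ˡ n x _) (cong (x *_) (sym (hom-refinedγ-suc m k u v))))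
                     (sym (hom-refinedγ-suc m (N ∸ k) u v)) ⟩
      x * r (suc m) k + r (suc m) (N ∸ k) ∎
      where
      distrib : ∀ (x a b c : ℤ) → a * (x * b + c) ≡ x * (a * b) + a * c
      distrib = solve-∀

  lastSum-evenLen : ∀ m g → lastSum (evenLen m) g ≡ Σ< (evenLen m) (λ ℓ → (x * r m ℓ + r m (evenLen m ∸ suc ℓ)) * g ℓ)
  lastSum-evenLen zero    g = base x (g 0) (g 1)
    -- By computation: 10 contributes x · g 0 and 01 contributes g 1.
    where
    base : ∀ (x a b : ℤ) → (x * 1ℤ) * 1ℤ * a + (1ℤ * 1ℤ * b + 0ℤ) ≡ 0ℤ + (x * 1ℤ + 0ℤ) * a + (x * 0ℤ + 1ℤ) * b
    base = solve-∀
  lastSum-evenLen (suc m) g = begin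
    lastSum (suc (suc n)) g
      ≡⟨ lastSum-step′ n true (alternate-evenLen m true) g ⟩
    lastSum (suc n) (λ j → Σ< (suc N) (λ k → oddFactor j k * g k))
      ≡⟨ lastSum-step′ (oddLen m) false (alternate-oddLen m true) _ ⟩
    lastSum n (λ ℓ → Σ< N (λ j → stepFactor false ℓ j * Σ< (suc N) (λ k → oddFactor j k * g k)))
      ≡⟨ lastSum-evenLen m _ ⟩
    Σ< n (λ ℓ → (x * r m ℓ + r m (n ∸ suc ℓ)) * Σ< N (λ j → stepFactor false ℓ j * Σ< (suc N) (λ k → oddFactor j k * g k)))
      ≡⟨ Σ<-cong n (λ ℓ → cong ((x * r m ℓ + r m (n ∸ suc ℓ)) *_)
           (Σ<-cong N (λ j → cong (_* Σ< (suc N) (λ k → oddFactor j k * g k)) (stepFactor-even ℓ j)))) ⟩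
    Σ< n (λ ℓ → (x * r m ℓ + r m (n ∸ suc ℓ)) * Σ< N (λ j → evenFactor ℓ j * Σ< (suc N) (λ k → oddFactor j k * g k)))
      ≡⟨ two-steps m g ⟩
    Σ< (suc N) (λ k → (x * r (suc m) k + r (suc m) (N ∸ k)) * g k) ∎
    where
    open ≡-Reasoning
    n = evenLen m
    N = suc n

  weightSum-evenLen : ∀ m → (1ℤ + y) * sumℤ (map weight (perms (evenLen m))) ≡ hom (suc m) u v (γEven m)
  weightSum-evenLen m = begin
    (1ℤ + y) * sumℤ (map weight (perms n))
      ≡⟨ cong ((1ℤ + y) *_) (trans (sym (lastSum-const-1 n)) (lastSum-evenLen m (λ _ → 1ℤ))) ⟩
    (1ℤ + y) * Σ< n (λ ℓ → (x * r m ℓ + r m (n ∸ suc ℓ)) * 1ℤ)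
      ≡⟨ cong ((1ℤ + y) *_) (trans (Σ<-cong n (λ ℓ → ℤP.*-identityʳ _)) (Σ<-+ n _ _)) ⟩
    (1ℤ + y) * (Σ< n (λ ℓ → x * r m ℓ) + Σ< n (λ ℓ → r m (n ∸ suc ℓ)))
      ≡⟨ cong (λ s → (1ℤ + y) * s) (cong₂ _+_ (Σ<-*ˡ n x (r m)) (Σ<-reverse n (r m))) ⟩
    (1ℤ + y) * (x * Σ< n (r m) + Σ< n (r m))
      ≡⟨ factor x y (Σ< n (r m)) ⟩
    (1ℤ + y) * (1ℤ + x) * Σ< n (r m)
      ≡⟨ cong (_* Σ< n (r m)) u+v ⟨
    (u + v) * Σ< n (r m)
      ≡⟨ ℤP.*-distribʳ-+ (Σ< n (r m)) u v ⟩
    u * Σ< n (r m) + v * Σ< n (r m)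
      ≡⟨ cong₂ _+_ (Σ<-*ˡ n u (r m)) (Σ<-*ˡ n v (r m)) ⟨
    Σ< n (λ ℓ → u * r m ℓ) + Σ< n (λ ℓ → v * r m ℓ)
      ≡⟨ Σ<-+ n _ _ ⟨
    Σ< n (λ ℓ → u * r m ℓ + v * r m ℓ)
      ≡⟨ Σ<-cong n (λ ℓ → cong₂ _+_ (hom-padTop m u v (refinedγ m ℓ)) (hom-shiftUp m u v (refinedγ m ℓ))) ⟨
    Σ< n (λ ℓ → hom (suc m) u v (padTop m (refinedγ m ℓ)) + hom (suc m) u v (shiftUp (refinedγ m ℓ)))
      ≡⟨ Σ<-cong n (λ ℓ → hom-+ (suc m) u v (padTop m (refinedγ m ℓ)) (shiftUp (refinedγ m ℓ))) ⟨
    Σ< n (λ ℓ → hom (suc m) u v (λ t → padTop m (refinedγ m ℓ) t + shiftUp (refinedγ m ℓ) t))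
      ≡⟨ hom-Σ< (suc m) u v n (λ ℓ t → padTop m (refinedγ m ℓ) t + shiftUp (refinedγ m ℓ) t) ⟨
    hom (suc m) u v (γEven m) ∎
    where
    open ≡-Reasoning
    n = evenLen m
    factor : ∀ (x y s : ℤ) → (1ℤ + y) * (x * s + s) ≡ (1ℤ + y) * (1ℤ + x) * s
    factor = solve-∀

  weightSum-oddLen : ∀ m → sumℤ (map weight (perms (suc (evenLen m)))) ≡ hom (suc m) u v (γOdd m)
  weightSum-oddLen m = begin
    sumℤ (map weight (perms (suc n)))
      ≡⟨ sym (lastSum-const-1 (suc n)) ⟩
    lastSum (suc n) (λ _ → 1ℤ)
      ≡⟨ lastSum-step′ (oddLen m) false (alternate-oddLen m true) _ ⟩
    lastSum n (λ ℓ → Σ< N (λ k → stepFactor false ℓ k * 1ℤ))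
      ≡⟨ lastSum-cong n (λ ℓ → Σ<-cong N (λ k → trans (ℤP.*-identityʳ _) (stepFactor-even ℓ k))) ⟩
    lastSum n (λ ℓ → Σ< N (evenFactor ℓ))
      ≡⟨ lastSum-evenLen m _ ⟩
    Σ< n (λ ℓ → (x * r m ℓ + r m (n ∸ suc ℓ)) * Σ< N (evenFactor ℓ))
      ≡⟨ Σ<-reflect n x (r m) (λ ℓ → Σ< N (evenFactor ℓ)) ⟩
    Σ< n (λ ℓ → r m ℓ * (x * Σ< N (evenFactor ℓ) + Σ< N (evenFactor (n ∸ suc ℓ))))
      ≡⟨ Σ<-cong-< n (λ ℓ ℓ<n → cong (r m ℓ *_) (letter-weights ℓ ℓ<n)) ⟩
    Σ< n (λ ℓ → r m ℓ * (+ suc ℓ * u + + (n ∸ ℓ) * v))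
      ≡⟨ Σ<-cong n (λ ℓ → spread (+ suc ℓ) (+ (n ∸ ℓ)) u v (r m ℓ)) ⟩
    Σ< n (λ ℓ → + suc ℓ * (u * r m ℓ) + + (n ∸ ℓ) * (v * r m ℓ))
      ≡⟨ Σ<-cong n (λ ℓ → cong₂ (λ p s → + suc ℓ * p + + (n ∸ ℓ) * s)
                       (hom-padTop m u v (refinedγ m ℓ)) (hom-shiftUp m u v (refinedγ m ℓ))) ⟨
    Σ< n (λ ℓ → + suc ℓ * hom (suc m) u v (padTop m (ρ ℓ)) + + (n ∸ ℓ) * hom (suc m) u v (shiftUp (ρ ℓ)))
      ≡⟨ Σ<-cong n (λ ℓ → trans (hom-+ (suc m) u v (λ t → + suc ℓ * padTop m (ρ ℓ) t) (λ t → + (n ∸ ℓ) * shiftUp (ρ ℓ) t))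
                       (cong₂ _+_ (hom-* (suc m) u v (+ suc ℓ) (padTop m (ρ ℓ))) (hom-* (suc m) u v (+ (n ∸ ℓ)) (shiftUp (ρ ℓ))))) ⟨
    Σ< n (λ ℓ → hom (suc m) u v (λ t → + suc ℓ * padTop m (ρ ℓ) t + + (n ∸ ℓ) * shiftUp (ρ ℓ) t))
      ≡⟨ hom-Σ< (suc m) u v n (λ ℓ t → + suc ℓ * padTop m (ρ ℓ) t + + (n ∸ ℓ) * shiftUp (ρ ℓ) t) ⟨
    hom (suc m) u v (γOdd m) ∎
    where
    open ≡-Reasoning
    n = evenLen m
    N = suc n
    ρ = refinedγ m
    spread : ∀ (A B u v s : ℤ) → s * (A * u + B * v) ≡ A * (u * s) + B * (v * s)
    spread = solve-∀
    letter-weights : ∀ ℓ → ℓ < n →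
      x * Σ< N (evenFactor ℓ) + Σ< N (evenFactor (n ∸ suc ℓ)) ≡ + suc ℓ * u + + (n ∸ ℓ) * v
    letter-weights ℓ ℓ<n =
      trans (cong₂ (λ a b → x * a + b) (evenFactor-Σ< N ℓ) (evenFactor-Σ< N (n ∸ suc ℓ)))
            (odd-identity-at (+ suc ℓ) (+ (n ∸ ℓ))
              (split-length ℓ<n) (countAtLeast-above ℓ<n) (countAtLeast-reflect ℓ<n))

-- The γ-expansions of Ã_n and Ā_n

gammaTerm : (ℕ → ℕ → ℕ) → ℕ → ℤ → ℤ → ℕ → ℤ
gammaTerm c n x y j = (+ c n j * (x + y) ^ j) * (1ℤ + x * y) ^ (n / 2 ∸ j)

-- Defs sums through where-bound helpers, which cannot be named from outside; each is captured
-- by a top-level metavariable that the with-abstracted clause below solves.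
mutual
  sumOfA : ℕ → ℤ → ℤ → List ℤ → ℤ
  sumOfA = _

  A≡sumOfA : ∀ n x y → A n x y ≡ sumOfA n x y (map (λ σ → x ^ des₁ σ * y ^ des₀ σ) (perms n))
  A≡sumOfA n x y with map (λ σ → x ^ des₁ σ * y ^ des₀ σ) (perms n)
  ... | zs = refl

mutual
  sumOfÂ : ℕ → ℤ → ℤ → List ℤ → ℤ
  sumOfÂ = _

  Â≡sumOfÂ : ∀ n x y → Â n x y ≡ sumOfÂ n x y (map (λ σ → x ^ des₁ σ * y ^ asc₀ σ) (perms n))
  Â≡sumOfÂ n x y with map (λ σ → x ^ des₁ σ * y ^ asc₀ σ) (perms n)
  ... | zs = refl

mutual
  sumOfGamma : (ℕ → ℕ → ℕ) → ℕ → ℤ → ℤ → List ℕ → ℤ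
  sumOfGamma = _

  gammaSum≡sumOfGamma : ∀ c n x y → gammaSum c n x y ≡ gammaTerm c n x y 0 + sumOfGamma c n x y (applyUpTo suc (n / 2))
  gammaSum≡sumOfGamma c n x y with applyUpTo suc (n / 2)
  ... | js = refl

A-as-sumℤ : ∀ n x y → A n x y ≡ sumℤ (map (λ σ → x ^ des₁ σ * y ^ des₀ σ) (perms n))
A-as-sumℤ n x y = trans (A≡sumOfA n x y)
  (trans (sumℤ-unique (sumOfA n x y) id refl (λ _ _ → refl) zs) (cong sumℤ (LP.map-id zs)))
  where zs = map (λ σ → x ^ des₁ σ * y ^ des₀ σ) (perms n)

Â-as-sumℤ : ∀ n x y → Â n x y ≡ sumℤ (map (λ σ → x ^ des₁ σ * y ^ asc₀ σ) (perms n))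
Â-as-sumℤ n x y = trans (Â≡sumOfÂ n x y)
  (trans (sumℤ-unique (sumOfÂ n x y) id refl (λ _ _ → refl) zs) (cong sumℤ (LP.map-id zs)))
  where zs = map (λ σ → x ^ des₁ σ * y ^ asc₀ σ) (perms n)

gammaSum-as-hom : ∀ c n x y → gammaSum c n x y ≡ hom (n / 2) (1ℤ + x * y) (x + y) (λ j → + c n j)
gammaSum-as-hom c n x y = begin
  gammaSum c n x y
    ≡⟨ gammaSum≡sumOfGamma c n x y ⟩
  gammaTerm c n x y 0 + sumOfGamma c n x y (applyUpTo suc (n / 2))
    ≡⟨ cong (λ s → gammaTerm c n x y 0 + s)
         (sumℤ-unique (sumOfGamma c n x y) (gammaTerm c n x y) refl (λ _ _ → refl) (applyUpTo suc (n / 2))) ⟩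
  sumℤ (map (gammaTerm c n x y) (upTo (suc (n / 2))))         ≡⟨ sumℤ-upTo (gammaTerm c n x y) (suc (n / 2)) ⟩
  Σ< (suc (n / 2)) (gammaTerm c n x y)                        ≡⟨ hom-as-Σ< (n / 2) (1ℤ + x * y) (x + y) (λ j → + c n j) ⟨
  hom (n / 2) (1ℤ + x * y) (x + y) (λ j → + c n j)            ∎
  where open ≡-Reasoning

stepFactor-even-A : ∀ x y ℓ j → Weights.stepFactor _>ᵇ_ x y false ℓ j ≡ Kernel.evenFactor x y 1ℤ ℓ j
stepFactor-even-A x y ℓ j = trans (cong (λ b → if b then y else 1ℤ) (<ᵇ-punchIn j ℓ)) (flip (ℓ <ᵇ j))
  where
  flip : ∀ b → (if not b then y else 1ℤ) ≡ (if b then 1ℤ else y)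
  flip true  = refl
  flip false = refl

stepFactor-even-Â : ∀ x y ℓ j → Weights.stepFactor _<ᵇ_ x y false ℓ j ≡ Kernel.evenFactor x 1ℤ y ℓ j
stepFactor-even-Â x y ℓ j = cong (λ b → if b then y else 1ℤ) (punchIn-<ᵇ-self j ℓ)

kernel-identity-A : ∀ (x y A B K M₁ M₃ : ℤ) →
  x * ((A + B) * y + B * (1ℤ - y) + ((A + B) - K) * (y * (x - 1ℤ)) + M₁ * ((1ℤ - y) * (x - 1ℤ)))
  + ((A + B) * y + A * (1ℤ - y) + ((A + B) - K) * (y * (x - 1ℤ)) + (M₃ + A - K) * ((1ℤ - y) * (x - 1ℤ)))
  ≡ x * (((A + B) - K) * (1ℤ + x * y) + M₁ * ((x + y) - (1ℤ + x * y))) + (K * (1ℤ + x * y) + M₃ * ((x + y) - (1ℤ + x * y)))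
kernel-identity-A = solve-∀

odd-identity-A : ∀ (x y A B : ℤ) →
  x * ((A + B) * y + B * (1ℤ - y)) + ((A + B) * y + A * (1ℤ - y)) ≡ A * (1ℤ + x * y) + B * (x + y)
odd-identity-A = solve-∀

kernel-identity-Â : ∀ (x y A B K M₁ M₃ : ℤ) →
  x * ((A + B) * 1ℤ + B * (y - 1ℤ) + ((A + B) - K) * (1ℤ * (x - 1ℤ)) + M₁ * ((y - 1ℤ) * (x - 1ℤ)))
  + ((A + B) * 1ℤ + A * (y - 1ℤ) + ((A + B) - K) * (1ℤ * (x - 1ℤ)) + (M₃ + A - K) * ((y - 1ℤ) * (x - 1ℤ)))
  ≡ x * (((A + B) - K) * (x + y) + M₁ * ((1ℤ + x * y) - (x + y))) + (K * (x + y) + M₃ * ((1ℤ + x * y) - (x + y)))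
kernel-identity-Â = solve-∀

odd-identity-Â : ∀ (x y A B : ℤ) →
  x * ((A + B) * 1ℤ + B * (y - 1ℤ)) + ((A + B) * 1ℤ + A * (y - 1ℤ)) ≡ A * (x + y) + B * (1ℤ + x * y)
odd-identity-Â = solve-∀

u+v-A : ∀ (x y : ℤ) → (1ℤ + x * y) + (x + y) ≡ (1ℤ + y) * (1ℤ + x)
u+v-A = solve-∀

u+v-Â : ∀ (x y : ℤ) → (x + y) + (1ℤ + x * y) ≡ (1ℤ + y) * (1ℤ + x)
u+v-Â = solve-∀

module RecurrenceA (x y : ℤ) = Recurrence _>ᵇ_ (λ k a b → punchIn-<ᵇ k b a) x y (1ℤ + x * y) (x + y) y 1ℤ
  (stepFactor-even-A x y) (kernel-identity-A x y) (odd-identity-A x y) (u+v-A x y)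

module RecurrenceÂ (x y : ℤ) = Recurrence _<ᵇ_ (λ k a b → punchIn-<ᵇ k a b) x y (x + y) (1ℤ + x * y) 1ℤ y
  (stepFactor-even-Â x y) (kernel-identity-Â x y) (odd-identity-Â x y) (u+v-Â x y)

data Length : ℕ → Set where
  one  : Length 1
  even : ∀ m → Length (evenLen m)
  odd  : ∀ m → Length (suc (evenLen m))

length-view : ∀ n → 1 ≤ n → Length n
length-view (suc zero)          _ = one
length-view (suc (suc zero))    _ = even 0
length-view (suc (suc (suc n))) _ with length-view (suc n) (s≤s z≤n)
... | one    = odd 0
... | even m = even (suc m)
... | odd m  = odd (suc m)

γ : ∀ {n} → Length n → Coeffs
γ one      _ = 1ℤ
γ (even m)   = γEven m
γ (odd m)    = γOdd m

⌊n/2⌋≡n/2 : ∀ n → ⌊ n /2⌋ ≡ n / 2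
⌊n/2⌋≡n/2 zero          = refl
⌊n/2⌋≡n/2 (suc zero)    = refl
⌊n/2⌋≡n/2 (suc (suc n)) = trans (cong suc (⌊n/2⌋≡n/2 n)) (sym (m/n≡1+[m∸n]/n {suc (suc n)} {2} (s≤s (s≤s z≤n))))

evenLen/2 : ∀ m → evenLen m / 2 ≡ suc m
evenLen/2 m = trans (sym (⌊n/2⌋≡n/2 (evenLen m))) (halve m)
  where
  halve : ∀ m → ⌊ evenLen m /2⌋ ≡ suc m
  halve zero    = refl
  halve (suc m) = cong suc (halve m)

oddLen/2 : ∀ m → suc (evenLen m) / 2 ≡ suc m
oddLen/2 m = trans (sym (⌊n/2⌋≡n/2 (suc (evenLen m)))) (halve m)
  where
  halve : ∀ m → ⌊ suc (evenLen m) /2⌋ ≡ suc m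
  halve zero    = refl
  halve (suc m) = cong suc (halve m)

isEven-evenLen : ∀ m → isEven (evenLen m) ≡ true
isEven-evenLen zero    = refl
isEven-evenLen (suc m) = trans (not-involutive (isEven (evenLen m))) (isEven-evenLen m)

Ã-hom : ∀ {n} (len : Length n) x y → Ã n x y ≡ hom (n / 2) (1ℤ + x * y) (x + y) (γ len)
Ã-hom one      x y = refl
Ã-hom (even m) x y rewrite isEven-evenLen m | evenLen/2 m =
  trans (cong ((1ℤ + y) *_) (A-as-sumℤ (evenLen m) x y)) (RecurrenceA.weightSum-evenLen x y m)
Ã-hom (odd m)  x y rewrite isEven-evenLen m | oddLen/2 m =
  trans (A-as-sumℤ (suc (evenLen m)) x y) (RecurrenceA.weightSum-oddLen x y m)

Ā-hom : ∀ {n} (len : Length n) x y → Ā n x y ≡ hom (n / 2) (x + y) (1ℤ + x * y) (γ len)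
Ā-hom one      x y = refl
Ā-hom (even m) x y rewrite isEven-evenLen m | evenLen/2 m =
  trans (cong ((1ℤ + y) *_) (Â-as-sumℤ (evenLen m) x y)) (RecurrenceÂ.weightSum-evenLen x y m)
Ā-hom (odd m)  x y rewrite isEven-evenLen m | oddLen/2 m =
  trans (Â-as-sumℤ (suc (evenLen m)) x y) (RecurrenceÂ.weightSum-oddLen x y m)

-- Identifying the coefficients at y = 0

Σ<-delta : ∀ N d (f : ℕ → ℤ) → d < N → Σ< N (λ j → (if d ≡ᵇ j then 1ℤ else 0ℤ) * f j) ≡ f d
Σ<-delta (suc N) d f d<1+N with d ℕ.≟ N
... | yes refl rewrite ≡ᵇ-true (refl {x = d}) =
  trans (cong (_+ 1ℤ * f d)
          (Σ<-zero N (λ j j<d → cong (λ b → (if b then 1ℤ else 0ℤ) * f j) (≡ᵇ-false (<⇒≢ j<d ∘ sym)))))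
        (trans (ℤP.+-identityˡ _) (ℤP.*-identityˡ (f d)))
... | no d≢N rewrite ≡ᵇ-false d≢N =
  trans (cong (_+ 0ℤ) (Σ<-delta N d f (≤∧≢⇒< (s≤s⁻¹ d<1+N) d≢N))) (ℤP.+-identityʳ (f d))

module Counting (R : ℕ → ℕ → Bool) where

  counted : ℕ → List ℕ → Bool
  counted j σ = (des₁ σ ≡ᵇ j) ∧ (countAdj R false σ ≡ᵇ 0)

  count : List (List ℕ) → ℕ → ℕ
  count L j = length (filterᵇ (counted j) L)

  count-∷ : ∀ σ L j → + count (σ ∷ L) j ≡ (if counted j σ then 1ℤ else 0ℤ) + + count L j
  count-∷ σ L j with counted j σ
  ... | true  = refl
  ... | false = sym (ℤP.+-identityˡ _)

module _ (R : ℕ → ℕ → Bool) (x : ℤ) where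

  open Counting R
  open Weights R x 0ℤ using (weight)

  weight-at-0 : ∀ D σ → des₁ σ ≤ D → Σ< (suc D) (λ j → (if counted j σ then 1ℤ else 0ℤ) * x ^ j) ≡ weight σ
  weight-at-0 D σ des≤D with countAdj R false σ
  ... | zero  = trans (Σ<-cong (suc D) (λ j → cong (λ b → (if b then 1ℤ else 0ℤ) * x ^ j) (∧-true (des₁ σ ≡ᵇ j))))
                      (trans (Σ<-delta (suc D) (des₁ σ) (x ^_) (s≤s des≤D)) (sym (ℤP.*-identityʳ _)))
    where
    ∧-true : ∀ b → (b ∧ true) ≡ b
    ∧-true true  = refl
    ∧-true false = refl
  ... | suc c = trans (Σ<-zero (suc D) (λ j _ → cong (λ b → (if b then 1ℤ else 0ℤ) * x ^ j) (∧-false (des₁ σ ≡ᵇ j))))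
                      (sym (ℤP.*-zeroʳ (x ^ des₁ σ)))
    where
    ∧-false : ∀ b → (b ∧ false) ≡ false
    ∧-false true  = refl
    ∧-false false = refl

  weightSum-at-0 : ∀ D L → (∀ {σ} → σ ∈ L → des₁ σ ≤ D) →
                   sumℤ (map weight L) ≡ Σ< (suc D) (λ j → + count L j * x ^ j)
  weightSum-at-0 D []      _     = sym (Σ<-zero (suc D) (λ _ _ → refl))
  weightSum-at-0 D (σ ∷ L) des≤D = begin
    weight σ + sumℤ (map weight L)
      ≡⟨ cong₂ _+_ (sym (weight-at-0 D σ (des≤D (here refl)))) (weightSum-at-0 D L (des≤D ∘ there)) ⟩
    Σ< (suc D) (λ j → 𝟙 j * x ^ j) + Σ< (suc D) (λ j → + count L j * x ^ j)
      ≡⟨ Σ<-+ (suc D) _ _ ⟨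
    Σ< (suc D) (λ j → 𝟙 j * x ^ j + + count L j * x ^ j)
      ≡⟨ Σ<-cong (suc D) (λ j → trans (sym (ℤP.*-distribʳ-+ (x ^ j) (𝟙 j) (+ count L j)))
                                      (cong (_* x ^ j) (sym (count-∷ σ L j)))) ⟩
    Σ< (suc D) (λ j → + count (σ ∷ L) j * x ^ j) ∎
    where
    open ≡-Reasoning
    𝟙 : ℕ → ℤ
    𝟙 j = if counted j σ then 1ℤ else 0ℤ

countAdj-bound : ∀ (R : ℕ → ℕ → Bool) xs →
  countAdj R true xs ≤ ⌊ length xs /2⌋ × countAdj R false xs ≤ ⌊ ℕ.pred (length xs) /2⌋
countAdj-bound R []           = z≤n , z≤n
countAdj-bound R (a ∷ [])     = z≤n , z≤n
countAdj-bound R (a ∷ b ∷ xs) with countAdj-bound R (b ∷ xs)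
... | odd≤ , even≤ = +-mono-≤ (indicator≤1 (R a b)) even≤ , odd≤
  where
  indicator≤1 : ∀ c → indicator c ≤ 1
  indicator≤1 true  = ≤-refl
  indicator≤1 false = z≤n

des₁-bound : ∀ n {σ} → σ ∈ perms n → des₁ σ ≤ n / 2
des₁-bound n {σ} σ∈ = ≤-trans (proj₁ (countAdj-bound _>ᵇ_ σ))
  (≤-reflexive (trans (cong ⌊_/2⌋ (perms-length n σ∈)) (⌊n/2⌋≡n/2 n)))

hom-1-as-Σ< : ∀ d v (c : Coeffs) → hom d 1ℤ v c ≡ Σ< (suc d) (λ j → c j * v ^ j)
hom-1-as-Σ< d v c = trans (hom-as-Σ< d 1ℤ v c)
  (Σ<-cong (suc d) λ j → trans (cong (c j * v ^ j *_) (ℤP.^-zeroˡ (d ∸ j))) (ℤP.*-identityʳ _))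

coefficients-at-y=0 : ∀ R n (c : Coeffs) → (∀ x → sumℤ (map (Weights.weight R x 0ℤ) (perms n)) ≡ hom (n / 2) 1ℤ x c) →
  ∀ j → j ≤ n / 2 → c j ≡ + Counting.count R (perms n) j
coefficients-at-y=0 R n c weightSum≡ = hom-1-injective (n / 2) c (λ j → + Counting.count R (perms n) j) λ x → begin
  hom (n / 2) 1ℤ x c
    ≡⟨ weightSum≡ x ⟨
  sumℤ (map (Weights.weight R x 0ℤ) (perms n))
    ≡⟨ weightSum-at-0 R x (n / 2) (perms n) (des₁-bound n) ⟩
  Σ< (suc (n / 2)) (λ j → + Counting.count R (perms n) j * x ^ j)
    ≡⟨ hom-1-as-Σ< (n / 2) x _ ⟨
  hom (n / 2) 1ℤ x (λ j → + Counting.count R (perms n) j) ∎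
  where open ≡-Reasoning

hom-at-y=0 : ∀ d x (c : Coeffs) → hom d (1ℤ + x * 0ℤ) (x + 0ℤ) c ≡ hom d 1ℤ x c
hom-at-y=0 d x c = cong₂ (λ u v → hom d u v c) (cong (λ z → 1ℤ + z) (ℤP.*-zeroʳ x)) (ℤP.+-identityʳ x)

Ã-at-y=0 : ∀ n x → Ã n x 0ℤ ≡ A n x 0ℤ
Ã-at-y=0 n x with isEven n
... | true  = ℤP.*-identityˡ _
... | false = refl

Ā-at-y=0 : ∀ n x → Ā n x 0ℤ ≡ Â n x 0ℤ
Ā-at-y=0 n x with isEven n
... | true  = ℤP.*-identityˡ _
... | false = refl

γ≡a : ∀ {n} (len : Length n) j → j ≤ n / 2 → γ len j ≡ + a n j
γ≡a {n} len = coefficients-at-y=0 _>ᵇ_ n (γ len) λ x → begin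
  sumℤ (map (Weights.weight _>ᵇ_ x 0ℤ) (perms n))         ≡⟨ A-as-sumℤ n x 0ℤ ⟨
  A n x 0ℤ                                               ≡⟨ Ã-at-y=0 n x ⟨
  Ã n x 0ℤ                                               ≡⟨ Ã-hom len x 0ℤ ⟩
  hom (n / 2) (1ℤ + x * 0ℤ) (x + 0ℤ) (γ len)             ≡⟨ hom-at-y=0 (n / 2) x (γ len) ⟩
  hom (n / 2) 1ℤ x (γ len)                               ∎
  where open ≡-Reasoning

γ-reversed≡ā : ∀ {n} (len : Length n) j → j ≤ n / 2 → γ len (n / 2 ∸ j) ≡ + ā n j
γ-reversed≡ā {n} len = coefficients-at-y=0 _<ᵇ_ n (λ j → γ len (n / 2 ∸ j)) λ x → begin
  sumℤ (map (Weights.weight _<ᵇ_ x 0ℤ) (perms n))         ≡⟨ Â-as-sumℤ n x 0ℤ ⟨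
  Â n x 0ℤ                                               ≡⟨ Ā-at-y=0 n x ⟨
  Ā n x 0ℤ                                               ≡⟨ Ā-hom len x 0ℤ ⟩
  hom (n / 2) (x + 0ℤ) (1ℤ + x * 0ℤ) (γ len)             ≡⟨ hom-reverse (n / 2) (x + 0ℤ) (1ℤ + x * 0ℤ) (γ len) ⟩
  hom (n / 2) (1ℤ + x * 0ℤ) (x + 0ℤ) (λ j → γ len (n / 2 ∸ j)) ≡⟨ hom-at-y=0 (n / 2) x (λ j → γ len (n / 2 ∸ j)) ⟩
  hom (n / 2) 1ℤ x (λ j → γ len (n / 2 ∸ j))             ∎
  where open ≡-Reasoning

theorem2p5 : (n : ℕ) → 1 ≤ n →
    ((x y : ℤ) → Ã n x y ≡ gammaSum a n x y)
    × ((x y : ℤ) → Ā n x y ≡ gammaSum ā n x y)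
    × ((j : ℕ) → j ≤ n / 2 → ā n j ≡ a n (n / 2 ∸ j))
theorem2p5 n 1≤n = Ã-expansion , Ā-expansion , ā≡a
  where
  open ≡-Reasoning
  len = length-view n 1≤n
  D = n / 2
  Ã-expansion : ∀ x y → Ã n x y ≡ gammaSum a n x y
  Ã-expansion x y = begin
    Ã n x y                                            ≡⟨ Ã-hom len x y ⟩
    hom D (1ℤ + x * y) (x + y) (γ len)                 ≡⟨ hom-cong D _ _ (γ≡a len) ⟩
    hom D (1ℤ + x * y) (x + y) (λ j → + a n j)         ≡⟨ gammaSum-as-hom a n x y ⟨
    gammaSum a n x y                                   ∎
  Ā-expansion : ∀ x y → Ā n x y ≡ gammaSum ā n x y
  Ā-expansion x y = begin
    Ā n x y                                            ≡⟨ Ā-hom len x y ⟩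
    hom D (x + y) (1ℤ + x * y) (γ len)                 ≡⟨ hom-reverse D (x + y) (1ℤ + x * y) (γ len) ⟩
    hom D (1ℤ + x * y) (x + y) (λ j → γ len (D ∸ j))   ≡⟨ hom-cong D _ _ (γ-reversed≡ā len) ⟩
    hom D (1ℤ + x * y) (x + y) (λ j → + ā n j)         ≡⟨ gammaSum-as-hom ā n x y ⟨
    gammaSum ā n x y                                   ∎
  ā≡a : ∀ j → j ≤ D → ā n j ≡ a n (D ∸ j)
  ā≡a j j≤D = ℤP.+-injective (trans (sym (γ-reversed≡ā len j j≤D)) (γ≡a len (D ∸ j) (m∸n≤m D j)))
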